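{- For $E\ge 0$, let $a(E)$ denote the number of isomorphism classes of connected undirected multigraphs on exactly $4$ unlabeled vertices with exactly $E$ edges, where multiple edges between the same pair of distinct vertices are allowed but loops are not. Then \[ \sum_{E\ge 0} a(E)\,x^E=\frac{x^3\left(-x^{10}+x^9+2x^7-x^6+x^5-3x^4+x^2+x+2\right)}{(x-1)^6(1+x)^2(1+x^2)(1+x+x^2)^2}, \] so that $a(0),a(1),\dots = 0,0,0,2,5,11,22,37,61,95,141,203,288,\dots$.
   Context: A multigraph is counted up to isomorphism (relabeling of vertices). "Connected" means every vertex can be reached from every other vertex along edges; in particular every vertex has at least one edge to another vertex. -}

module Defs where

open import Data.Nat using (ℕ; zero; suc; _≤_; _<ᵇ_; _∸_)
open import Data.Fin using (Fin; toℕ)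
open import Data.Fin.Permutation using (Permutation′; _⟨$⟩ʳ_)
open import Data.List using (List; []; _∷_; map; allFin; upTo)
open import Data.Nat.ListAction using (sum)
open import Data.Vec using (Vec; lookup)
open import Data.Bool using (if_then_else_)
open import Data.Product using (Σ; _×_; ∃)
open import Data.Integer as ℤ using (ℤ; +_; -_)
open import Relation.Binary.PropositionalEquality using (_≡_)

record MultiGraph4 : Set where
  field
    m        : Fin 4 → Fin 4 → ℕ
    symm     : ∀ i j → m i j ≡ m j i
    loopless : ∀ i → m i i ≡ 0
open MultiGraph4 public

edgeCount : MultiGraph4 → ℕ
edgeCount g =
  sum (map (λ i → sum (map (λ j → if toℕ i <ᵇ toℕ j then m g i j else 0)
                           (allFin 4)))
           (allFin 4))

data Reach (g : MultiGraph4) : Fin 4 → Fin 4 → Set where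
  here : ∀ {i} → Reach g i i
  step : ∀ {i k j} → 1 ≤ m g i k → Reach g k j → Reach g i j

Connected : MultiGraph4 → Set
Connected g = ∀ i j → Reach g i j

Iso : MultiGraph4 → MultiGraph4 → Set
Iso g h = Σ (Permutation′ 4) λ σ → ∀ i j → m g (σ ⟨$⟩ʳ i) (σ ⟨$⟩ʳ j) ≡ m h i j

-- "there are exactly k isomorphism classes of connected multigraphs on 4
-- vertices with E edges": a list of k representatives, one from each class.
IsClassCount : ℕ → ℕ → Set
IsClassCount E k =
  Σ (Vec MultiGraph4 k) λ L →
    (∀ i → Connected (lookup L i) × edgeCount (lookup L i) ≡ E)
  × (∀ i j → Iso (lookup L i) (lookup L j) → i ≡ j)
  × (∀ g → Connected g → edgeCount g ≡ E → ∃ λ i → Iso g (lookup L i))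

-- Polynomials over ℤ as coefficient lists (lowest degree first).

Poly : Set
Poly = List ℤ

_⊕_ : Poly → Poly → Poly
[] ⊕ q = q
p ⊕ [] = p
(a ∷ p) ⊕ (b ∷ q) = (a ℤ.+ b) ∷ (p ⊕ q)

scale : ℤ → Poly → Poly
scale c = map (c ℤ.*_)

_⊗_ : Poly → Poly → Poly
[] ⊗ q = []
(a ∷ p) ⊗ q = scale a q ⊕ (+ 0 ∷ (p ⊗ q))

_^ₚ_ : Poly → ℕ → Poly
p ^ₚ zero = + 1 ∷ []
p ^ₚ suc n = p ⊗ (p ^ₚ n)

coeff : Poly → ℕ → ℤ
coeff [] n = + 0
coeff (a ∷ p) zero = a
coeff (a ∷ p) (suc n) = coeff p n

numerator : Poly
numerator = (+ 0 ∷ + 0 ∷ + 0 ∷ + 1 ∷ [])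
  ⊗ (+ 2 ∷ + 1 ∷ + 1 ∷ + 0 ∷ - + 3 ∷ + 1 ∷ - + 1 ∷ + 2 ∷ + 0 ∷ + 1 ∷ - + 1 ∷ [])

denominator : Poly
denominator = ((- + 1 ∷ + 1 ∷ []) ^ₚ 6)
  ⊗ (((+ 1 ∷ + 1 ∷ []) ^ₚ 2)
  ⊗ ((+ 1 ∷ + 0 ∷ + 1 ∷ [])
  ⊗ ((+ 1 ∷ + 1 ∷ + 1 ∷ []) ^ₚ 2)))

mulSeries : Poly → (ℕ → ℕ) → ℕ → ℤ
mulSeries P a n = sum' (map (λ i → coeff P i ℤ.* + a (n ∸ i)) (upTo (suc n)))
  where
  sum' : List ℤ → ℤ
  sum' [] = + 0
  sum' (x ∷ xs) = x ℤ.+ sum' xs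

-- Σ_E a(E) x^E = N(x)/D(x)  as formal power series; since D(0) = 1, D is
-- invertible in ℤ[[x]], so this is equivalent to  D(x)·Σ a(E) x^E = N(x).
HasGF : (ℕ → ℕ) → Poly → Poly → Set
HasGF a N D = ∀ n → mulSeries D a n ≡ coeff N n

-- A loopless multigraph on four vertices is a vector y ∈ ℕ⁶ of edge multiplicities, and
-- y = raise (support y) (lower y), where the support is the set of edges present and lower y
-- subtracts one from every nonzero entry.  Order such vectors by the binary code of their
-- supports, breaking ties recursively by the lower parts, and call y canonical for a group G
-- of vertex permutations if it is maximal in its G-orbit.  Then y is canonical exactly when
-- its support Q is maximal in its orbit and lower y is canonical for the stabiliser of Q.
-- Recursing along this characterisation enumerates one multigraph per isomorphism class;
-- connectivity depends only on the support.
--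
-- The same recursion shows that the number count G P n of canonical vectors with n edges
-- and support inside P satisfies count G P = δ + Σ_Q x^|Q| · count (Stab_G Q) Q, the sum
-- running over the orbit-maximal nonempty Q ⊆ P.  When G fixes P, the term Q = P occurs, so
-- after multiplying by the denominator D every node satisfies u = F + x^|P| · u with F built
-- from deeper nodes.  This equation has a unique solution, which is checked to be an explicit
-- polynomial at every node; summing over the connected supports gives D · Σ a(E) xᴱ = numerator.

module Submission where

open import Defs
open import Data.Nat.Base using (ℕ)
open import Data.Product.Base using (Σ; _×_; _,_)

module Enumeration where

  open import Data.Bool.Base as Bool using (Bool; true; false; T; _∧_; _∨_; if_then_else_)
  import Data.Bool.Properties as Bool
  open import Data.Bool.Properties using (T-∧; T-∨)
  open import Data.Empty using (⊥-elim)
  open import Data.Fin.Base using (Fin; toℕ; zero; suc)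
  open import Data.Fin.Patterns using (0F; 1F; 2F; 3F; 4F; 5F)
  open import Data.Fin.Permutation as Permutation using (Permutation′; _⟨$⟩ʳ_; _⟨$⟩ˡ_; inverseˡ; inverseʳ; permutation; _∘ₚ_)
  open import Data.Fin.Properties using (all?; any?; _≟_)
  open import Data.List.Base as List using (List; []; _∷_; concat; concatMap; filter; length; [_]; _++_)
  import Data.List.Properties as List
  open import Data.List.Extrema.Nat using (argmax; argmax-all; f[xs]≤f[argmax])
  open import Data.List.Membership.Propositional using (_∈_; find; lose)
  open import Data.List.Membership.Propositional.Properties using (∈-map⁺; ∈-map⁻; ∈-++⁺ˡ; ∈-++⁺ʳ; ∈-++⁻; ∈-concatMap⁺; ∈-concatMap⁻; ∈-filter⁺; ∈-filter⁻; ∈-allFin; ∈-lookup)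
  open import Data.List.Relation.Unary.All as All using (All)
  import Data.List.Relation.Unary.All.Properties as All
  import Data.List.Relation.Unary.AllPairs as AllPairs
  import Data.List.Relation.Unary.AllPairs.Properties as AllPairs
  open import Data.List.Relation.Unary.Any as Any using (here)
  open import Data.List.Relation.Unary.Any.Properties using (lookup-index)
  open import Data.List.Relation.Unary.Unique.Propositional using (Unique)
  import Data.List.Relation.Unary.Unique.Propositional.Properties as Unique
  open import Data.Maybe.Base using (Maybe; just; nothing; maybe)
  import Data.Maybe.Properties as Maybe
  open import Data.Nat.Base using (ℕ; zero; suc; pred; _+_; _*_; _^_; _∸_; _≤_; _<_; z≤n; s≤s; _<ᵇ_)
  open import Data.Nat.ListAction using (sum)
  open import Data.Nat.Properties using (+-commutativeSemigroup; +-0-commutativeMonoid; *-cancelˡ-≡; suc-injective; +-cancelˡ-≡; <-irrefl; <-asym; ≤-trans; ≤-refl; m≤m+n; +-monoʳ-<; +-identityʳ; _<?_; _≤?_; 0≢1+n; ∸-monoʳ-≤; ∸-monoˡ-≤; m+[n∸m]≡n; m+n∸m≡n; <-≤-trans; m≤n⇒m<n∨m≡n; m<n+m; n≤1+n)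
  import Data.Nat.Properties as ℕ
  open import Algebra.Properties.CommutativeSemigroup +-commutativeSemigroup using (x∙yz≈y∙xz)
  import Algebra.Properties.CommutativeMonoid.Sum +-0-commutativeMonoid as ∑ℕ
  open import Data.Nat.Tactic.RingSolver using (solve-∀)
  open import Data.Product.Base using (∃; _×_; _,_; proj₁; proj₂)
  import Data.Product.Properties as Product
  open import Data.Sum.Base using (_⊎_; inj₁; inj₂; [_,_]′; map₁)
  open import Data.Vec.Base as Vec using (Vec; []; _∷_; lookup; tabulate; replicate)
  open import Data.Vec.Properties using (lookup-map; tabulate-∘; lookup∘tabulate; tabulate∘lookup; tabulate-cong; lookup-replicate; ∷-injective; ∷-injectiveʳ)
  import Data.Vec.Properties as Vec
  open import Data.Vec.Relation.Binary.Pointwise.Inductive as Pointwise using (Pointwise; []; _∷_)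
  open import Function.Base using (id; _∘_)
  open import Function.Bundles using (Equivalence)
  open import Relation.Binary.Definitions using (DecidableEquality)
  open import Relation.Binary.PropositionalEquality using (_≡_; _≢_; refl; sym; trans; cong; cong₂; subst; subst₂; module ≡-Reasoning)
  open import Relation.Nullary.Decidable using (Dec; yes; no; isYes; T?; toWitness; fromWitness; from-yes; ¬?; _×-dec_; _⊎-dec_; _→-dec_)
  open import Relation.Nullary.Negation using (¬_)
  open import Relation.Unary using (Decidable)

  private variable n : ℕ

  -- Edge vectors and relabelling

  EdgeVec : Set → Set
  EdgeVec A = Vec A 6

  endpoints : Fin 6 → Fin 4 × Fin 4
  endpoints 0F = 0F , 1F
  endpoints 1F = 0F , 2F
  endpoints 2F = 0F , 3F
  endpoints 3F = 1F , 2F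
  endpoints 4F = 1F , 3F
  endpoints 5F = 2F , 3F

  source target : Fin 6 → Fin 4
  source = proj₁ ∘ endpoints
  target = proj₂ ∘ endpoints

  edgeIndex : Fin 4 → Fin 4 → Maybe (Fin 6)
  edgeIndex 0F 1F = just 0F
  edgeIndex 0F 2F = just 1F
  edgeIndex 0F 3F = just 2F
  edgeIndex 1F 2F = just 3F
  edgeIndex 1F 3F = just 4F
  edgeIndex 2F 3F = just 5F
  edgeIndex 1F 0F = just 0F
  edgeIndex 2F 0F = just 1F
  edgeIndex 3F 0F = just 2F
  edgeIndex 2F 1F = just 3F
  edgeIndex 3F 1F = just 4F
  edgeIndex 3F 2F = just 5F
  edgeIndex _  _  = nothing

  _≟ᵉ_ : DecidableEquality (Maybe (Fin 6))
  _≟ᵉ_ = Maybe.≡-dec _≟_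

  edgeIndex-sym : ∀ i j → edgeIndex i j ≡ edgeIndex j i
  edgeIndex-sym = from-yes (all? λ i → all? λ j → edgeIndex i j ≟ᵉ edgeIndex j i)

  edgeIndex-diag : ∀ i → edgeIndex i i ≡ nothing
  edgeIndex-diag = from-yes (all? λ i → edgeIndex i i ≟ᵉ nothing)

  edgeIndex-nothing : ∀ i j → edgeIndex i j ≡ nothing → i ≡ j
  edgeIndex-nothing = from-yes (all? λ i → all? λ j → (edgeIndex i j ≟ᵉ nothing) →-dec (i ≟ j))

  edgeIndex-just : ∀ i j e → edgeIndex i j ≡ just e → endpoints e ≡ (i , j) ⊎ endpoints e ≡ (j , i)
  edgeIndex-just = from-yes (all? λ i → all? λ j → all? λ e →
    (edgeIndex i j ≟ᵉ just e) →-dec (endpoints e ≟² (i , j) ⊎-dec endpoints e ≟² (j , i)))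
    where
    _≟²_ : DecidableEquality (Fin 4 × Fin 4)
    _≟²_ = Product.≡-dec _≟_ _≟_

  edgeIndex-endpoints : ∀ e → edgeIndex (source e) (target e) ≡ just e
  edgeIndex-endpoints = from-yes (all? λ e → edgeIndex (source e) (target e) ≟ᵉ just e)

  module _ {A : Set} where

    adjacency : A → EdgeVec A → Fin 4 → Fin 4 → A
    adjacency d y i j = maybe (lookup y) d (edgeIndex i j)

    relabel : A → (Fin 4 → Fin 4) → EdgeVec A → EdgeVec A
    relabel d f y = tabulate λ e → adjacency d y (f (source e)) (f (target e))

    adjacency-sym : ∀ d y i j → adjacency d y i j ≡ adjacency d y j i
    adjacency-sym d y i j = cong (maybe (lookup y) d) (edgeIndex-sym i j)

    adjacency-diag : ∀ d y i → adjacency d y i i ≡ d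
    adjacency-diag d y i = cong (maybe (lookup y) d) (edgeIndex-diag i)

    adjacency-endpoints : ∀ d y e → adjacency d y (source e) (target e) ≡ lookup y e
    adjacency-endpoints d y e = cong (maybe (lookup y) d) (edgeIndex-endpoints e)

    adjacency-relabel : ∀ d f y i j → adjacency d (relabel d f y) i j ≡ adjacency d y (f i) (f j)
    adjacency-relabel d f y i j with edgeIndex i j in eq
    ... | nothing rewrite edgeIndex-nothing i j eq = sym (adjacency-diag d y (f j))
    ... | just e with edgeIndex-just i j e eq
    ...   | inj₁ ends rewrite lookup∘tabulate (λ e → adjacency d y (f (source e)) (f (target e))) e | ends = refl
    ...   | inj₂ ends rewrite lookup∘tabulate (λ e → adjacency d y (f (source e)) (f (target e))) e | ends = adjacency-sym d y (f j) (f i)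

    relabel-cong : ∀ d {f g} → (∀ i → f i ≡ g i) → ∀ y → relabel d f y ≡ relabel d g y
    relabel-cong d f≗g y = tabulate-cong λ e → cong₂ (adjacency d y) (f≗g (source e)) (f≗g (target e))

    relabel-id : ∀ d y → relabel d id y ≡ y
    relabel-id d y = trans (tabulate-cong (adjacency-endpoints d y)) (tabulate∘lookup y)

    relabel-∘ : ∀ d f g y → relabel d f (relabel d g y) ≡ relabel d (g ∘ f) y
    relabel-∘ d f g y = tabulate-cong λ e → adjacency-relabel d g y (f (source e)) (f (target e))

    relabel-replicate : ∀ d f → relabel d f (replicate 6 d) ≡ replicate 6 d
    relabel-replicate d f = tabulate-cong λ e → adjacency-replicate (f (source e)) (f (target e))
      where
      adjacency-replicate : ∀ i j → adjacency d (replicate 6 d) i j ≡ d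
      adjacency-replicate i j with edgeIndex i j
      ... | nothing = refl
      ... | just e  = lookup-replicate e d

    relabel-adjacency : ∀ d f y z → (∀ i j → adjacency d y (f i) (f j) ≡ adjacency d z i j) → relabel d f y ≡ z
    relabel-adjacency d f y z same = trans (tabulate-cong λ e → same (source e) (target e)) (relabel-id d z)

  module _ {A B : Set} (h : A → B) where

    adjacency-map : ∀ d y i j → adjacency (h d) (Vec.map h y) i j ≡ h (adjacency d y i j)
    adjacency-map d y i j with edgeIndex i j
    ... | nothing = refl
    ... | just e  = lookup-map e h y

    map-relabel : ∀ d f y → Vec.map h (relabel d f y) ≡ relabel (h d) f (Vec.map h y)
    map-relabel d f y = trans (sym (tabulate-∘ h λ e → adjacency d y (f (source e)) (f (target e))))
                              (tabulate-cong λ e → sym (adjacency-map d y (f (source e)) (f (target e))))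

  -- Isomorphism invariants

  toGraph : EdgeVec ℕ → MultiGraph4
  toGraph y = record { m = adjacency 0 y ; symm = adjacency-sym 0 y ; loopless = adjacency-diag 0 y }

  fromGraph : MultiGraph4 → EdgeVec ℕ
  fromGraph g = tabulate λ e → m g (source e) (target e)

  adjacency-fromGraph : ∀ g i j → adjacency 0 (fromGraph g) i j ≡ m g i j
  adjacency-fromGraph g i j with edgeIndex i j in eq
  ... | nothing rewrite edgeIndex-nothing i j eq = sym (loopless g j)
  ... | just e with edgeIndex-just i j e eq
  ...   | inj₁ ends rewrite lookup∘tabulate (λ e → m g (source e) (target e)) e | ends = refl
  ...   | inj₂ ends rewrite lookup∘tabulate (λ e → m g (source e) (target e)) e | ends = symm g j i

  edgeCount-cong : ∀ {g h} → (∀ i j → m g i j ≡ m h i j) → edgeCount g ≡ edgeCount h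
  edgeCount-cong g≗h = cong sum (List.map-cong (λ i → cong sum (List.map-cong (λ j →
    cong (λ n → if toℕ i <ᵇ toℕ j then n else 0) (g≗h i j)) (List.allFin 4))) (List.allFin 4))

  edgeCount-toGraph : ∀ y → edgeCount (toGraph y) ≡ Vec.sum y
  edgeCount-toGraph (a ∷ b ∷ c ∷ d ∷ e ∷ f ∷ []) = reassociate a b c d e f
    where
    reassociate : ∀ a b c d e f →
      (a + (b + (c + 0))) + ((d + (e + 0)) + ((f + 0) + 0)) ≡ a + (b + (c + (d + (e + (f + 0)))))
    reassociate = solve-∀

  edgeCount-fromGraph : ∀ g → edgeCount g ≡ Vec.sum (fromGraph g)
  edgeCount-fromGraph g = trans (edgeCount-cong {g} {toGraph (fromGraph g)} λ i j → sym (adjacency-fromGraph g i j))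
                                (edgeCount-toGraph (fromGraph g))

  degreeSum : MultiGraph4 → ℕ
  degreeSum g = ∑ℕ.sum λ i → ∑ℕ.sum λ j → m g i j

  degreeSum-cong : ∀ {g h} → (∀ i j → m g i j ≡ m h i j) → degreeSum g ≡ degreeSum h
  degreeSum-cong g≗h = ∑ℕ.sum-cong-≗ λ i → ∑ℕ.sum-cong-≗ (g≗h i)

  handshake : ∀ g → degreeSum g ≡ 2 * edgeCount g
  handshake g = begin
    degreeSum g                         ≡⟨ degreeSum-cong {g} {toGraph y} (λ i j → sym (adjacency-fromGraph g i j)) ⟩
    degreeSum (toGraph y)               ≡⟨ twice y ⟩
    2 * Vec.sum y                       ≡⟨ cong (2 *_) (edgeCount-fromGraph g) ⟨
    2 * edgeCount g                     ∎
    where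
    open ≡-Reasoning
    y = fromGraph g
    twice : ∀ y → degreeSum (toGraph y) ≡ 2 * Vec.sum y
    twice (a ∷ b ∷ c ∷ d ∷ e ∷ f ∷ []) = each-edge-twice a b c d e f
      where
      each-edge-twice : ∀ a b c d e f →
        a + (b + (c + 0)) + (a + (d + (e + 0)) + (b + (d + (f + 0)) + (c + (e + (f + 0)) + 0)))
          ≡ 2 * (a + (b + (c + (d + (e + (f + 0))))))
      each-edge-twice = solve-∀

  degreeSum-Iso : ∀ {g h} → Iso g h → degreeSum g ≡ degreeSum h
  degreeSum-Iso {g} {h} (σ , g∘σ≗h) = begin
    degreeSum g                                      ≡⟨ ∑ℕ.sum-permute (λ i → ∑ℕ.sum (m g i)) σ ⟩
    ∑ℕ.sum (λ i → ∑ℕ.sum (m g (σ ⟨$⟩ʳ i)))            ≡⟨ ∑ℕ.sum-cong-≗ (λ i → ∑ℕ.sum-permute (m g (σ ⟨$⟩ʳ i)) σ) ⟩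
    ∑ℕ.sum (λ i → ∑ℕ.sum (λ j → m g (σ ⟨$⟩ʳ i) (σ ⟨$⟩ʳ j))) ≡⟨ ∑ℕ.sum-cong-≗ (λ i → ∑ℕ.sum-cong-≗ (g∘σ≗h i)) ⟩
    degreeSum h                                      ∎
    where open ≡-Reasoning

  edgeCount-Iso : ∀ {g h} → Iso g h → edgeCount g ≡ edgeCount h
  edgeCount-Iso {g} {h} g≅h = *-cancelˡ-≡ (edgeCount g) (edgeCount h) 2
    (trans (sym (handshake g)) (trans (degreeSum-Iso {g} {h} g≅h) (handshake h)))

  Connected-Iso : ∀ {g h} → Iso g h → Connected g → Connected h
  Connected-Iso {g} {h} (σ , g∘σ≗h) g-connected i j =
    subst₂ (Reach h) (inverseˡ σ) (inverseˡ σ) (transport (g-connected (σ ⟨$⟩ʳ i) (σ ⟨$⟩ʳ j)))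
    where
    edge : ∀ a b → m g a b ≡ m h (σ ⟨$⟩ˡ a) (σ ⟨$⟩ˡ b)
    edge a b = trans (sym (cong₂ (m g) (inverseʳ σ) (inverseʳ σ))) (g∘σ≗h (σ ⟨$⟩ˡ a) (σ ⟨$⟩ˡ b))
    transport : ∀ {a b} → Reach g a b → Reach h (σ ⟨$⟩ˡ a) (σ ⟨$⟩ˡ b)
    transport here = here
    transport (step {i = a} {k} 1≤m r) = step (subst (1 ≤_) (edge a k) 1≤m) (transport r)

  relabel-Iso : ∀ (σ : Permutation′ 4) y → Iso (toGraph y) (toGraph (relabel 0 (σ ⟨$⟩ʳ_) y))
  relabel-Iso σ y = σ , λ i j → sym (adjacency-relabel 0 (σ ⟨$⟩ʳ_) y i j)

  vectors : ∀ {A : Set} → List A → (n : ℕ) → List (Vec A n)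
  vectors xs zero    = [ [] ]
  vectors xs (suc n) = concatMap (λ x → List.map (x ∷_) (vectors xs n)) xs

  module _ {A : Set} {xs : List A} where

    ∈-vectors : (∀ x → x ∈ xs) → ∀ {n} (v : Vec A n) → v ∈ vectors xs n
    ∈-vectors complete []      = here refl
    ∈-vectors complete (x ∷ v) =
      ∈-concatMap⁺ _ (Any.map (λ { refl → ∈-map⁺ (x ∷_) (∈-vectors complete v) }) (complete x))

  Perm : Set
  Perm = Vec (Fin 4) 4

  IsBijective : Perm → Set
  IsBijective π = (∀ i j → lookup π i ≡ lookup π j → i ≡ j) × (∀ j → ∃ λ i → lookup π i ≡ j)

  isBijective? : Decidable IsBijective
  isBijective? π = (all? λ i → all? λ j → (lookup π i ≟ lookup π j) →-dec (i ≟ j))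
             ×-dec (all? λ j → any? λ i → lookup π i ≟ j)

  -- opaque because unfolding this list during unification is expensive; only the final
  -- computation of the generating function unfolds it
  opaque
    permutations : List Perm
    permutations = filter isBijective? (vectors (List.allFin 4) 4)

    ∈permutations⇒bijective : ∀ {π} → π ∈ permutations → IsBijective π
    ∈permutations⇒bijective = proj₂ ∘ ∈-filter⁻ isBijective? {xs = vectors (List.allFin 4) 4}

    tabulate∈permutations : ∀ (σ : Permutation′ 4) → tabulate (σ ⟨$⟩ʳ_) ∈ permutations
    tabulate∈permutations σ = ∈-filter⁺ isBijective? (∈-vectors ∈-allFin _) (injective , onto)
      where
      injective : ∀ i j → lookup (tabulate (σ ⟨$⟩ʳ_)) i ≡ lookup (tabulate (σ ⟨$⟩ʳ_)) j → i ≡ j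
      injective i j eq = begin
        i                             ≡⟨ inverseˡ σ ⟨
        σ ⟨$⟩ˡ (σ ⟨$⟩ʳ i)              ≡⟨ cong (σ ⟨$⟩ˡ_) (trans (sym (lookup∘tabulate (σ ⟨$⟩ʳ_) i))
                                                           (trans eq (lookup∘tabulate (σ ⟨$⟩ʳ_) j))) ⟩
        σ ⟨$⟩ˡ (σ ⟨$⟩ʳ j)              ≡⟨ inverseˡ σ ⟩
        j                             ∎
        where open ≡-Reasoning
      onto : ∀ j → ∃ λ i → lookup (tabulate (σ ⟨$⟩ʳ_)) i ≡ j
      onto j = σ ⟨$⟩ˡ j , trans (lookup∘tabulate (σ ⟨$⟩ʳ_) (σ ⟨$⟩ˡ j)) (inverseʳ σ)

  toPermutation : ∀ {π} → π ∈ permutations → Permutation′ 4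
  toPermutation {π} π∈ =
    permutation (lookup π) (proj₁ ∘ onto) (proj₂ ∘ onto) (λ i → injective _ i (proj₂ (onto (lookup π i))))
    where
    injective : ∀ i j → lookup π i ≡ lookup π j → i ≡ j
    injective = proj₁ (∈permutations⇒bijective π∈)
    onto : ∀ j → ∃ λ i → lookup π i ≡ j
    onto = proj₂ (∈permutations⇒bijective π∈)

  _⊙_ : Perm → Perm → Perm
  π ⊙ ρ = tabulate (lookup π ∘ lookup ρ)

  identityᵖ : Perm
  identityᵖ = Vec.allFin 4

  ⊙∈permutations : ∀ {π ρ} → π ∈ permutations → ρ ∈ permutations → π ⊙ ρ ∈ permutations
  ⊙∈permutations π∈ ρ∈ = tabulate∈permutations (toPermutation ρ∈ ∘ₚ toPermutation π∈)

  record IsSubgroup (G : List Perm) : Set where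
    field
      ⊆permutations : ∀ {π} → π ∈ G → π ∈ permutations
      identity∈     : identityᵖ ∈ G
      ⊙-closed      : ∀ {π ρ} → π ∈ G → ρ ∈ G → π ⊙ ρ ∈ G

  symmetricGroup : IsSubgroup permutations
  symmetricGroup = record
    { ⊆permutations = λ π∈ → π∈
    ; identity∈     = tabulate∈permutations Permutation.id
    ; ⊙-closed      = ⊙∈permutations
    }

  infixr 6 _·_

  _·_ : Perm → EdgeVec ℕ → EdgeVec ℕ
  π · y = relabel 0 (lookup π) y

  relabel-⊙ : ∀ {A : Set} (d : A) π ρ y → relabel d (lookup (π ⊙ ρ)) y ≡ relabel d (lookup ρ) (relabel d (lookup π) y)
  relabel-⊙ d π ρ y =
    trans (relabel-cong d (lookup∘tabulate (lookup π ∘ lookup ρ)) y) (sym (relabel-∘ d (lookup ρ) (lookup π) y))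

  sum-· : ∀ {π} → π ∈ permutations → ∀ y → Vec.sum (π · y) ≡ Vec.sum y
  sum-· {π} π∈ y = begin
    Vec.sum (π · y)                ≡⟨ edgeCount-toGraph (π · y) ⟨
    edgeCount (toGraph (π · y))    ≡⟨ edgeCount-Iso {toGraph y} {toGraph (π · y)} (relabel-Iso (toPermutation π∈) y) ⟨
    edgeCount (toGraph y)          ≡⟨ edgeCount-toGraph y ⟩
    Vec.sum y                      ∎
    where open ≡-Reasoning

  -- Supports

  nonzero : ℕ → Bool
  nonzero zero    = false
  nonzero (suc _) = true

  support : Vec ℕ n → Vec Bool n
  support = Vec.map nonzero

  lower : Vec ℕ n → Vec ℕ n
  lower = Vec.map pred

  raise : Vec Bool n → Vec ℕ n → Vec ℕ n
  raise = Vec.zipWith λ b k → if b then suc k else k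

  size : Vec Bool n → ℕ
  size = Vec.count T?

  _⊆_ : Vec Bool n → Vec Bool n → Set
  _⊆_ = Pointwise Bool._≤_

  ∅ : Vec Bool n
  ∅ = replicate _ false

  𝟎 : Vec ℕ n
  𝟎 = replicate _ 0

  full : Vec Bool n
  full = replicate _ true

  ⊆full : ∀ (Q : Vec Bool n) → Q ⊆ full
  ⊆full []      = []
  ⊆full (b ∷ Q) = Bool.≤-maximum b ∷ ⊆full Q

  raise-support-lower : ∀ (y : Vec ℕ n) → raise (support y) (lower y) ≡ y
  raise-support-lower []            = refl
  raise-support-lower (zero  ∷ y)   = cong (0 ∷_) (raise-support-lower y)
  raise-support-lower (suc k ∷ y)   = cong (suc k ∷_) (raise-support-lower y)

  support-raise : ∀ Q (y : Vec ℕ n) → support y ⊆ Q → support (raise Q y) ≡ Q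
  support-raise []          []          []          = refl
  support-raise (true ∷ Q)  (k ∷ y)     (_ ∷ y⊆Q)   = cong (true ∷_) (support-raise Q y y⊆Q)
  support-raise (false ∷ Q) (zero ∷ y)  (_ ∷ y⊆Q)   = cong (false ∷_) (support-raise Q y y⊆Q)

  lower-raise : ∀ Q (y : Vec ℕ n) → support y ⊆ Q → lower (raise Q y) ≡ y
  lower-raise []          []          []          = refl
  lower-raise (true ∷ Q)  (k ∷ y)     (_ ∷ y⊆Q)   = cong (k ∷_) (lower-raise Q y y⊆Q)
  lower-raise (false ∷ Q) (zero ∷ y)  (_ ∷ y⊆Q)   = cong (0 ∷_) (lower-raise Q y y⊆Q)

  support-lower-⊆ : ∀ (y : Vec ℕ n) → support (lower y) ⊆ support y
  support-lower-⊆ []                = []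
  support-lower-⊆ (zero ∷ y)        = Bool.b≤b ∷ support-lower-⊆ y
  support-lower-⊆ (suc zero ∷ y)    = Bool.f≤t ∷ support-lower-⊆ y
  support-lower-⊆ (suc (suc k) ∷ y) = Bool.b≤b ∷ support-lower-⊆ y

  raise-injective : ∀ Q {y z : Vec ℕ n} → raise Q y ≡ raise Q z → y ≡ z
  raise-injective []          {[]}    {[]}    _  = refl
  raise-injective (true ∷ Q)  {_ ∷ _} {_ ∷ _} eq =
    cong₂ _∷_ (suc-injective (proj₁ (∷-injective eq))) (raise-injective Q (proj₂ (∷-injective eq)))
  raise-injective (false ∷ Q) {_ ∷ _} {_ ∷ _} eq =
    cong₂ _∷_ (proj₁ (∷-injective eq)) (raise-injective Q (proj₂ (∷-injective eq)))

  sum-raise : ∀ Q (y : Vec ℕ n) → Vec.sum (raise Q y) ≡ size Q + Vec.sum y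
  sum-raise []          []      = refl
  sum-raise (true ∷ Q)  (k ∷ y) = cong suc (trans (cong (k +_) (sum-raise Q y)) (x∙yz≈y∙xz k (size Q) (Vec.sum y)))
  sum-raise (false ∷ Q) (k ∷ y) = trans (cong (k +_) (sum-raise Q y)) (x∙yz≈y∙xz k (size Q) (Vec.sum y))

  sum-support-lower : ∀ (y : Vec ℕ n) → Vec.sum y ≡ size (support y) + Vec.sum (lower y)
  sum-support-lower y = trans (cong Vec.sum (sym (raise-support-lower y))) (sum-raise (support y) (lower y))

  support≡∅ : ∀ (y : Vec ℕ n) → support y ≡ ∅ → y ≡ 𝟎
  support≡∅ []         _  = refl
  support≡∅ (zero ∷ y) eq = cong (0 ∷_) (support≡∅ y (proj₂ (∷-injective eq)))

  ∅⊆ : ∀ (P : Vec Bool n) → ∅ ⊆ P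
  ∅⊆ []      = []
  ∅⊆ (b ∷ P) = Bool.≤-minimum b ∷ ∅⊆ P

  sum≡0⇒𝟎 : ∀ (y : Vec ℕ n) → Vec.sum y ≡ 0 → y ≡ 𝟎
  sum≡0⇒𝟎 []         _  = refl
  sum≡0⇒𝟎 (zero ∷ y) eq = cong (0 ∷_) (sum≡0⇒𝟎 y eq)

  support≢∅ : ∀ {y : Vec ℕ n} → y ≢ 𝟎 → support y ≢ ∅
  support≢∅ {y = y} y≢𝟎 = y≢𝟎 ∘ support≡∅ y

  size-nonempty : ∀ (Q : Vec Bool n) → Q ≢ ∅ → 1 ≤ size Q
  size-nonempty []          Q≢∅ = ⊥-elim (Q≢∅ refl)
  size-nonempty (true ∷ Q)  _   = s≤s z≤n
  size-nonempty (false ∷ Q) Q≢∅ = size-nonempty Q (Q≢∅ ∘ cong (false ∷_))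

  code : Vec Bool n → ℕ
  code []                = 0
  code {suc n} (b ∷ v) = (if b then 2 ^ n else 0) + code v

  code<2^n : ∀ (v : Vec Bool n) → code v < 2 ^ n
  code<2^n []                    = s≤s z≤n
  code<2^n {suc n} (true ∷ v)  = +-monoʳ-< (2 ^ n) (subst (code v <_) (sym (+-identityʳ (2 ^ n))) (code<2^n v))
  code<2^n {suc n} (false ∷ v) = ≤-trans (code<2^n v) (m≤m+n (2 ^ n) (2 ^ n + 0))

  code-injective : ∀ (v w : Vec Bool n) → code v ≡ code w → v ≡ w
  code-injective []          []          _  = refl
  code-injective {suc n} (true ∷ v)  (true ∷ w)  eq = cong (true ∷_) (code-injective v w (+-cancelˡ-≡ (2 ^ n) _ _ eq))
  code-injective (false ∷ v) (false ∷ w) eq = cong (false ∷_) (code-injective v w eq)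
  code-injective {suc n} (true ∷ v)  (false ∷ w) eq =
    ⊥-elim (<-irrefl refl (≤-trans (code<2^n w) (subst (2 ^ n ≤_) eq (m≤m+n (2 ^ n) (code v)))))
  code-injective {suc n} (false ∷ v) (true ∷ w)  eq =
    ⊥-elim (<-irrefl refl (≤-trans (code<2^n v) (subst (2 ^ n ≤_) (sym eq) (m≤m+n (2 ^ n) (code w)))))

  subpatterns : Vec Bool n → List (Vec Bool n)
  subpatterns []          = [ [] ]
  subpatterns (true ∷ P)  = withOrWithout (subpatterns P)
    where withOrWithout : List (Vec Bool _) → List (Vec Bool _)
          withOrWithout Qs = List.map (true ∷_) Qs ++ List.map (false ∷_) Qs
  subpatterns (false ∷ P) = List.map (false ∷_) (subpatterns P)

  ∈-subpatterns⁺ : ∀ {Q P : Vec Bool n} → Q ⊆ P → Q ∈ subpatterns P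
  ∈-subpatterns⁺ {Q = []}         []              = here refl
  ∈-subpatterns⁺ {Q = true ∷ Q}  (Bool.b≤b ∷ Q⊆P) = ∈-++⁺ˡ (∈-map⁺ (true ∷_) (∈-subpatterns⁺ Q⊆P))
  ∈-subpatterns⁺ {Q = false ∷ Q} {true ∷ P}  (_ ∷ Q⊆P) =
    ∈-++⁺ʳ (List.map (true ∷_) (subpatterns P)) (∈-map⁺ (false ∷_) (∈-subpatterns⁺ Q⊆P))
  ∈-subpatterns⁺ {Q = false ∷ Q} {false ∷ P} (_ ∷ Q⊆P) = ∈-map⁺ (false ∷_) (∈-subpatterns⁺ Q⊆P)

  ∈-subpatterns⁻ : ∀ {Q} (P : Vec Bool n) → Q ∈ subpatterns P → Q ⊆ P
  ∈-subpatterns⁻ []          (here refl) = []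
  ∈-subpatterns⁻ (true ∷ P)  Q∈ with ∈-++⁻ (List.map (true ∷_) (subpatterns P)) Q∈
  ... | inj₁ Q∈₁ with ∈-map⁻ (true ∷_) Q∈₁
  ...   | Q′ , Q′∈ , refl = Bool.b≤b ∷ ∈-subpatterns⁻ P Q′∈
  ∈-subpatterns⁻ (true ∷ P)  Q∈ | inj₂ Q∈₂ with ∈-map⁻ (false ∷_) Q∈₂
  ...   | Q′ , Q′∈ , refl = Bool.f≤t ∷ ∈-subpatterns⁻ P Q′∈
  ∈-subpatterns⁻ (false ∷ P) Q∈ with ∈-map⁻ (false ∷_) Q∈
  ... | Q′ , Q′∈ , refl = Bool.b≤b ∷ ∈-subpatterns⁻ P Q′∈

  subpatterns-unique : ∀ (P : Vec Bool n) → Unique (subpatterns P)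
  subpatterns-unique []          = All.[] AllPairs.∷ AllPairs.[]
  subpatterns-unique (true ∷ P)  =
    Unique.++⁺ (Unique.map⁺ ∷-injectiveʳ (subpatterns-unique P)) (Unique.map⁺ ∷-injectiveʳ (subpatterns-unique P)) disjoint
    where
    disjoint : ∀ {Q} → ¬ (Q ∈ List.map (true ∷_) (subpatterns P) × Q ∈ List.map (false ∷_) (subpatterns P))
    disjoint (Q∈₁ , Q∈₂) with ∈-map⁻ (true ∷_) Q∈₁ | ∈-map⁻ (false ∷_) Q∈₂
    ... | _ , _ , refl | _ , _ , ()
  subpatterns-unique (false ∷ P) = Unique.map⁺ ∷-injectiveʳ (subpatterns-unique P)

  -- The canonical order

  Pattern : Set
  Pattern = EdgeVec Bool

  _≟ₚ_ : DecidableEquality Pattern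
  _≟ₚ_ = Vec.≡-dec Bool._≟_

  infixr 6 _·ₚ_
  infix 4 _⊑_ _≼_ _≟ₚ_

  _·ₚ_ : Perm → Pattern → Pattern
  π ·ₚ Q = relabel false (lookup π) Q

  ·ₚ-⊙ : ∀ π ρ Q → (π ⊙ ρ) ·ₚ Q ≡ ρ ·ₚ π ·ₚ Q
  ·ₚ-⊙ = relabel-⊙ false

  identity-·ₚ : ∀ Q → identityᵖ ·ₚ Q ≡ Q
  identity-·ₚ Q = trans (relabel-cong false Vec.lookup-allFin Q) (relabel-id false Q)

  support-· : ∀ π y → support (π · y) ≡ π ·ₚ support y
  support-· π y = map-relabel nonzero 0 (lookup π) y

  lower-· : ∀ π y → lower (π · y) ≡ π · lower y
  lower-· π y = map-relabel pred 0 (lookup π) y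

  ·-𝟎 : ∀ π → π · 𝟎 ≡ 𝟎
  ·-𝟎 π = relabel-replicate 0 (lookup π)

  data _≼_ : EdgeVec ℕ → EdgeVec ℕ → Set where
    both-𝟎    : ∀ {y z} → y ≡ 𝟎 → z ≡ 𝟎 → y ≼ z
    support-< : ∀ {y z} → code (support y) < code (support z) → y ≼ z
    support-≡ : ∀ {y z} → support y ≡ support z → lower y ≼ lower z → y ≼ z

  ≼-antisym : ∀ {y z} → y ≼ z → z ≼ y → y ≡ z
  ≼-antisym (both-𝟎 y≡𝟎 z≡𝟎) _                 = trans y≡𝟎 (sym z≡𝟎)
  ≼-antisym _                 (both-𝟎 z≡𝟎 y≡𝟎) = trans y≡𝟎 (sym z≡𝟎)
  ≼-antisym (support-< y<z)   (support-< z<y)   = ⊥-elim (<-asym y<z z<y)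
  ≼-antisym (support-< y<z)   (support-≡ z≡y _) = ⊥-elim (<-irrefl (cong code (sym z≡y)) y<z)
  ≼-antisym (support-≡ y≡z _) (support-< z<y)   = ⊥-elim (<-irrefl (cong code (sym y≡z)) z<y)
  ≼-antisym {y} {z} (support-≡ y≡z y≼z) (support-≡ _ z≼y) = begin
    y                               ≡⟨ raise-support-lower y ⟨
    raise (support y) (lower y)     ≡⟨ cong₂ raise y≡z (≼-antisym y≼z z≼y) ⟩
    raise (support z) (lower z)     ≡⟨ raise-support-lower z ⟩
    z                               ∎
    where open ≡-Reasoning

  _⊑_ : Pattern → Pattern → Set
  Q′ ⊑ Q = Q′ ≡ Q ⊎ code Q′ < code Q

  OrbitMax : List Perm → Pattern → Set
  OrbitMax G Q = All (λ π → π ·ₚ Q ⊑ Q) G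

  orbitMax? : ∀ G Q → Dec (OrbitMax G Q)
  orbitMax? G Q = All.all? (λ π → (π ·ₚ Q ≟ₚ Q) ⊎-dec (code (π ·ₚ Q) <? code Q)) G

  Canonical : List Perm → EdgeVec ℕ → Set
  Canonical G y = All (λ π → π · y ≼ y) G

  stabilizer : List Perm → Pattern → List Perm
  stabilizer G Q = filter (λ π → π ·ₚ Q ≟ₚ Q) G

  ∈-stabilizer⁻ : ∀ {G Q π} → π ∈ stabilizer G Q → π ∈ G × π ·ₚ Q ≡ Q
  ∈-stabilizer⁻ {G} {Q} = ∈-filter⁻ (λ π → π ·ₚ Q ≟ₚ Q) {xs = G}

  ∈-stabilizer⁺ : ∀ {G Q π} → π ∈ G → π ·ₚ Q ≡ Q → π ∈ stabilizer G Q
  ∈-stabilizer⁺ {G} {Q} = ∈-filter⁺ (λ π → π ·ₚ Q ≟ₚ Q) {xs = G}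

  ·-≼-intro : ∀ π y → (π ·ₚ support y ≡ support y × π · lower y ≼ lower y) ⊎ code (π ·ₚ support y) < code (support y) →
              π · y ≼ y
  ·-≼-intro π y (inj₁ (fixed , lower≼)) =
    support-≡ (trans (support-· π y) fixed) (subst (_≼ lower y) (sym (lower-· π y)) lower≼)
  ·-≼-intro π y (inj₂ smaller) = support-< (subst (λ S → code S < code (support y)) (sym (support-· π y)) smaller)

  ·-≼-elim : ∀ π {y} → y ≢ 𝟎 → π · y ≼ y →
             (π ·ₚ support y ≡ support y × π · lower y ≼ lower y) ⊎ code (π ·ₚ support y) < code (support y)
  ·-≼-elim π y≢𝟎 (both-𝟎 _ y≡𝟎)          = ⊥-elim (y≢𝟎 y≡𝟎)
  ·-≼-elim π {y} _ (support-< smaller)   = inj₂ (subst (λ S → code S < code (support y)) (support-· π y) smaller)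
  ·-≼-elim π {y} _ (support-≡ fixed lower≼) =
    inj₁ (trans (sym (support-· π y)) fixed , subst (_≼ lower y) (lower-· π y) lower≼)

  canonical-𝟎 : ∀ G → Canonical G 𝟎
  canonical-𝟎 G = All.universal (λ π → both-𝟎 (·-𝟎 π) refl) G

  canonical-raise : ∀ {G Q y} → support y ⊆ Q → OrbitMax G Q → Canonical (stabilizer G Q) y → Canonical G (raise Q y)
  canonical-raise {G} {Q} {y} y⊆Q Q-max y-canonical = All.tabulate λ {π} π∈G → ·-≼-intro π (raise Q y) (compare π∈G)
    where
    compare : ∀ {π} → π ∈ G → (π ·ₚ support (raise Q y) ≡ support (raise Q y) × π · lower (raise Q y) ≼ lower (raise Q y))
                              ⊎ code (π ·ₚ support (raise Q y)) < code (support (raise Q y))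
    compare {π} π∈G rewrite support-raise Q y y⊆Q | lower-raise Q y y⊆Q with All.lookup Q-max π∈G
    ... | inj₁ fixed   = inj₁ (fixed , All.lookup y-canonical (∈-stabilizer⁺ π∈G fixed))
    ... | inj₂ smaller = inj₂ smaller

  canonical⇒orbitMax : ∀ {G y} → y ≢ 𝟎 → Canonical G y → OrbitMax G (support y)
  canonical⇒orbitMax {y = y} y≢𝟎 = All.map λ {π} π·y≼y → map₁ proj₁ (·-≼-elim π y≢𝟎 π·y≼y)

  canonical-lower : ∀ {G y} → y ≢ 𝟎 → Canonical G y → Canonical (stabilizer G (support y)) (lower y)
  canonical-lower {G} {y} y≢𝟎 y-canonical = All.tabulate λ {π} π∈stab →
    let π∈G , fixed = ∈-stabilizer⁻ {G} {support y} π∈stab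
    in [ proj₂ , (λ smaller → ⊥-elim (<-irrefl (cong code fixed) smaller)) ]′ (·-≼-elim π y≢𝟎 (All.lookup y-canonical π∈G))

  -- Orderly enumeration

  IsChild : List Perm → Pattern → Pattern → Set
  IsChild G P Q = Q ⊆ P × Q ≢ ∅ × OrbitMax G Q

  children : List Perm → Pattern → List Pattern
  children G P = filter (λ Q → ¬? (Q ≟ₚ ∅) ×-dec orbitMax? G Q) (subpatterns P)

  ∈-children⁻ : ∀ {G P Q} → Q ∈ children G P → IsChild G P Q
  ∈-children⁻ {G} {P} Q∈ =
    let Q∈subpatterns , properties = ∈-filter⁻ (λ Q → ¬? (Q ≟ₚ ∅) ×-dec orbitMax? G Q) {xs = subpatterns P} Q∈
    in ∈-subpatterns⁻ P Q∈subpatterns , properties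

  ∈-children⁺ : ∀ {G P Q} → IsChild G P Q → Q ∈ children G P
  ∈-children⁺ {G} {P} {Q} (Q⊆P , properties) =
    ∈-filter⁺ (λ Q → ¬? (Q ≟ₚ ∅) ×-dec orbitMax? G Q) (∈-subpatterns⁺ Q⊆P) properties

  child-nonempty : ∀ {G P Q} → Q ∈ children G P → Q ≢ ∅
  child-nonempty {G} {P} = proj₁ ∘ proj₂ ∘ ∈-children⁻ {G} {P}

  child-size : ∀ {G P Q} → Q ∈ children G P → 1 ≤ size Q
  child-size {G} {P} {Q} Q∈ = size-nonempty Q (child-nonempty {G} {P} Q∈)

  children-unique : ∀ G P → Unique (children G P)
  children-unique G P = Unique.filter⁺ (λ Q → ¬? (Q ≟ₚ ∅) ×-dec orbitMax? G Q) (subpatterns-unique P)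

  concatMap⁺ : ∀ {A B : Set} {f : A → List B} {xs} → Unique xs → (∀ {x} → Unique (f x)) →
               (∀ {x x′ y} → y ∈ f x → y ∈ f x′ → x ≡ x′) → Unique (concatMap f xs)
  concatMap⁺ xs! f! disjoint = Unique.concat⁺ (All.map⁺ (All.universal (λ _ → f!) _))
    (AllPairs.map⁺ (AllPairs.map (λ x≢x′ {_} (y∈ , y∈′) → x≢x′ (disjoint y∈ y∈′)) xs!))

  -- fuel only bounds the recursion: any fuel ≥ n gives the same list (enumerate-fuel)
  mutual
    enumerate : ℕ → List Perm → Pattern → ℕ → List (EdgeVec ℕ)
    enumerate _          G P zero    = [ 𝟎 ]
    enumerate zero       G P (suc n) = []
    enumerate (suc fuel) G P (suc n) = concatMap (λ Q → extend fuel G Q (suc n)) (children G P)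

    extend : ℕ → List Perm → Pattern → ℕ → List (EdgeVec ℕ)
    extend fuel G Q n with size Q ≤? n
    ... | yes _ = List.map (raise Q) (enumerate fuel (stabilizer G Q) Q (n ∸ size Q))
    ... | no  _ = []

  mutual
    enumerate-sound : ∀ fuel G P n {y} → y ∈ enumerate fuel G P n → Canonical G y × Vec.sum y ≡ n × support y ⊆ P
    enumerate-sound _          G P zero    (here refl) = canonical-𝟎 G , refl , ∅⊆ P
    enumerate-sound (suc fuel) G P (suc n) y∈ with find (∈-concatMap⁻ (λ Q → extend fuel G Q (suc n)) {xs = children G P} y∈)
    ... | Q , Q∈ , y∈extend with ∈-children⁻ {G} {P} Q∈
    ...   | Q⊆P , _ , Q-max with extend-sound fuel G Q (suc n) y∈extend Q-max
    ...     | y-canonical , sum-y , refl = y-canonical , sum-y , Q⊆P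

    extend-sound : ∀ fuel G Q n {y} → y ∈ extend fuel G Q n → OrbitMax G Q →
                   Canonical G y × Vec.sum y ≡ n × support y ≡ Q
    extend-sound fuel G Q n y∈ Q-max with size Q ≤? n
    ... | yes |Q|≤n with ∈-map⁻ (raise Q) y∈
    ...   | z , z∈ , refl with enumerate-sound fuel (stabilizer G Q) Q (n ∸ size Q) z∈
    ...     | z-canonical , sum-z , z⊆Q =
      canonical-raise z⊆Q Q-max z-canonical ,
      trans (sum-raise Q z) (trans (cong (size Q +_) sum-z) (m+[n∸m]≡n |Q|≤n)) ,
      support-raise Q z z⊆Q

  mutual
    enumerate-complete : ∀ fuel G P n {y} → n ≤ fuel → Canonical G y → Vec.sum y ≡ n → support y ⊆ P →
                         y ∈ enumerate fuel G P n
    enumerate-complete _          G P zero    {y} _         _           sum-y _   rewrite sum≡0⇒𝟎 y sum-y = here refl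
    enumerate-complete (suc fuel) G P (suc n) {y} (s≤s n≤f) y-canonical sum-y y⊆P =
      ∈-concatMap⁺ (λ Q → extend fuel G Q (suc n))
        (lose (∈-children⁺ (y⊆P , support≢∅ y≢𝟎 , canonical⇒orbitMax y≢𝟎 y-canonical))
              (extend-complete fuel G (suc n) (s≤s n≤f) y-canonical sum-y y≢𝟎))
      where
      y≢𝟎 : y ≢ 𝟎
      y≢𝟎 y≡𝟎 = 0≢1+n (trans (cong Vec.sum (sym y≡𝟎)) sum-y)

    extend-complete : ∀ fuel G n {y} → n ≤ suc fuel → Canonical G y → Vec.sum y ≡ n → y ≢ 𝟎 →
                      y ∈ extend fuel G (support y) n
    extend-complete fuel G n {y} n≤1+f y-canonical sum-y y≢𝟎 with size (support y) ≤? n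
    ... | no  |Q|≰n = ⊥-elim (|Q|≰n (subst (size (support y) ≤_) (trans (sym (sum-support-lower y)) sum-y) (m≤m+n _ _)))
    ... | yes _     = subst (_∈ List.map (raise Q) (enumerate fuel (stabilizer G Q) Q (n ∸ size Q))) (raise-support-lower y)
                        (∈-map⁺ (raise Q) (enumerate-complete fuel (stabilizer G Q) Q (n ∸ size Q)
                           (≤-trans (∸-monoʳ-≤ n 1≤|Q|) (∸-monoˡ-≤ 1 n≤1+f))
                           (canonical-lower y≢𝟎 y-canonical) sum-lower (support-lower-⊆ y)))
      where
      Q : Pattern
      Q = support y
      1≤|Q| : 1 ≤ size Q
      1≤|Q| = size-nonempty Q (support≢∅ y≢𝟎)
      sum-lower : Vec.sum (lower y) ≡ n ∸ size Q
      sum-lower = trans (sym (m+n∸m≡n (size Q) _)) (cong (_∸ size Q) (trans (sym (sum-support-lower y)) sum-y))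

  extend-support : ∀ fuel G Q n {y} → y ∈ extend fuel G Q n → support y ≡ Q
  extend-support fuel G Q n y∈ with size Q ≤? n
  ... | yes _ with ∈-map⁻ (raise Q) y∈
  ...   | z , z∈ , refl = support-raise Q z (proj₂ (proj₂ (enumerate-sound fuel (stabilizer G Q) Q (n ∸ size Q) z∈)))

  mutual
    enumerate-unique : ∀ fuel G P n → Unique (enumerate fuel G P n)
    enumerate-unique _          G P zero    = All.[] AllPairs.∷ AllPairs.[]
    enumerate-unique zero       G P (suc n) = AllPairs.[]
    enumerate-unique (suc fuel) G P (suc n) =
      concatMap⁺ (children-unique G P) (λ {Q} → extend-unique fuel G Q (suc n))
        (λ {Q} {Q′} y∈ y∈′ → trans (sym (extend-support fuel G Q (suc n) y∈)) (extend-support fuel G Q′ (suc n) y∈′))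

    extend-unique : ∀ fuel G Q n → Unique (extend fuel G Q n)
    extend-unique fuel G Q n with size Q ≤? n
    ... | yes _ = Unique.map⁺ (raise-injective Q) (enumerate-unique fuel (stabilizer G Q) Q (n ∸ size Q))
    ... | no  _ = AllPairs.[]

  mutual
    enumerate-fuel : ∀ {fuel fuel′} G P n → n ≤ fuel → n ≤ fuel′ → enumerate fuel G P n ≡ enumerate fuel′ G P n
    enumerate-fuel G P zero    _ _ = refl
    enumerate-fuel {suc fuel} {suc fuel′} G P (suc n) (s≤s n≤f) (s≤s n≤f′) =
      cong concat (List.map-cong-local (All.tabulate λ {Q} Q∈ →
        extend-fuel G Q (suc n) (child-size {G} {P} Q∈) (s≤s n≤f) (s≤s n≤f′)))

    extend-fuel : ∀ {fuel fuel′} G Q n → 1 ≤ size Q → n ≤ suc fuel → n ≤ suc fuel′ → extend fuel G Q n ≡ extend fuel′ G Q n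
    extend-fuel G Q n 1≤|Q| n≤f n≤f′ with size Q ≤? n
    ... | yes _ = cong (List.map (raise Q)) (enumerate-fuel (stabilizer G Q) Q (n ∸ size Q) (bound n≤f) (bound n≤f′))
      where
      bound : ∀ {f} → n ≤ suc f → n ∸ size Q ≤ f
      bound n≤f = ≤-trans (∸-monoʳ-≤ n 1≤|Q|) (∸-monoˡ-≤ 1 n≤f)
    ... | no  _ = refl

  -- Existence of canonical forms

  stabilizer-subgroup : ∀ {G} Q → IsSubgroup G → IsSubgroup (stabilizer G Q)
  stabilizer-subgroup {G} Q G-subgroup = record
    { ⊆permutations = ⊆permutations ∘ proj₁ ∘ ∈-stabilizer⁻ {G} {Q}
    ; identity∈     = ∈-stabilizer⁺ identity∈ (identity-·ₚ Q)
    ; ⊙-closed      = λ {π} {ρ} π∈ ρ∈ →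
        let π∈G , π-fixes = ∈-stabilizer⁻ {G} {Q} π∈
            ρ∈G , ρ-fixes = ∈-stabilizer⁻ {G} {Q} ρ∈
        in ∈-stabilizer⁺ (⊙-closed π∈G ρ∈G) (trans (·ₚ-⊙ π ρ Q) (trans (cong (ρ ·ₚ_) π-fixes) ρ-fixes))
    }
    where open IsSubgroup G-subgroup

  maximizer : List Perm → Pattern → Perm
  maximizer G S = argmax (λ π → code (π ·ₚ S)) identityᵖ G

  module _ {G} (G-subgroup : IsSubgroup G) (S : Pattern) where
    open IsSubgroup G-subgroup

    maximizer∈ : maximizer G S ∈ G
    maximizer∈ = argmax-all (λ π → code (π ·ₚ S)) identity∈ (All.tabulate λ π∈ → π∈)

    orbitMax-maximizer : OrbitMax G (maximizer G S ·ₚ S)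
    orbitMax-maximizer = All.tabulate λ {π} π∈ → compare {π} (m≤n⇒m<n∨m≡n (dominated π∈))
      where
      ρ : Perm
      ρ = maximizer G S
      dominated : ∀ {π} → π ∈ G → code (π ·ₚ ρ ·ₚ S) ≤ code (ρ ·ₚ S)
      dominated {π} π∈ = subst (λ S′ → code S′ ≤ code (ρ ·ₚ S)) (·ₚ-⊙ ρ π S)
        (All.lookup (f[xs]≤f[argmax] {f = λ π → code (π ·ₚ S)} identityᵖ G) (⊙-closed maximizer∈ π∈))
      compare : ∀ {π} → code (π ·ₚ ρ ·ₚ S) < code (ρ ·ₚ S) ⊎ code (π ·ₚ ρ ·ₚ S) ≡ code (ρ ·ₚ S) →
                π ·ₚ ρ ·ₚ S ⊑ ρ ·ₚ S
      compare (inj₁ smaller) = inj₂ smaller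
      compare (inj₂ same)    = inj₁ (code-injective _ _ same)

  canonical-extend : ∀ {G w τ} → OrbitMax G (support w) → τ ∈ stabilizer G (support w) →
                     Canonical (stabilizer G (support w)) (τ · lower w) → Canonical G (τ · w)
  canonical-extend {G} {w} {τ} Q-max τ∈ canonical = subst (Canonical G) (sym τ·w≡raise) (canonical-raise ⊆Q Q-max canonical)
    where
    Q : Pattern
    Q = support w
    support-τ·w : support (τ · w) ≡ Q
    support-τ·w = trans (support-· τ w) (proj₂ (∈-stabilizer⁻ {G} {Q} τ∈))
    τ·w≡raise : τ · w ≡ raise Q (τ · lower w)
    τ·w≡raise = trans (sym (raise-support-lower (τ · w))) (cong₂ raise support-τ·w (lower-· τ w))
    ⊆Q : support (τ · lower w) ⊆ Q
    ⊆Q = subst₂ _⊆_ (cong support (lower-· τ w)) support-τ·w (support-lower-⊆ (τ · w))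

  canonical-form : ∀ {G} → IsSubgroup G → ∀ y → ∃ λ π → π ∈ G × Canonical G (π · y)
  canonical-form G-subgroup y = bounded (suc (Vec.sum y)) G-subgroup y ≤-refl
    where
    bounded : ∀ h {G} → IsSubgroup G → ∀ y → Vec.sum y < h → ∃ λ π → π ∈ G × Canonical G (π · y)
    bounded (suc h) {G} G-subgroup y (s≤s sum≤h) with Vec.≡-dec ℕ._≟_ y 𝟎
    ... | yes refl = identityᵖ , identity∈ , subst (Canonical G) (sym (·-𝟎 identityᵖ)) (canonical-𝟎 G)
      where open IsSubgroup G-subgroup
    ... | no y≢𝟎   =
      let τ , τ∈ , canonical = bounded h (stabilizer-subgroup (support w) G-subgroup) (lower w) lower-smaller
      in ρ ⊙ τ , ⊙-closed ρ∈ (proj₁ (∈-stabilizer⁻ {G} {support w} τ∈)) ,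
         subst (Canonical G) (sym (relabel-⊙ 0 ρ τ y)) (canonical-extend w-max τ∈ canonical)
      where
      open IsSubgroup G-subgroup
      ρ : Perm
      ρ = maximizer G (support y)
      ρ∈ : ρ ∈ G
      ρ∈ = maximizer∈ G-subgroup (support y)
      w : EdgeVec ℕ
      w = ρ · y
      w-max : OrbitMax G (support w)
      w-max = subst (OrbitMax G) (sym (support-· ρ y)) (orbitMax-maximizer G-subgroup (support y))
      sum-w : Vec.sum w ≡ Vec.sum y
      sum-w = sum-· (⊆permutations ρ∈) y
      w≢𝟎 : w ≢ 𝟎
      w≢𝟎 w≡𝟎 = y≢𝟎 (sum≡0⇒𝟎 y (trans (sym sum-w) (cong Vec.sum w≡𝟎)))
      lower-smaller : Vec.sum (lower w) < h
      lower-smaller = <-≤-trans (subst (Vec.sum (lower w) <_) (trans (sym (sum-support-lower w)) sum-w)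
                                  (m<n+m _ (size-nonempty (support w) (support≢∅ w≢𝟎))))
                                sum≤h

  -- Connectivity

  reachesWithin : ℕ → Pattern → Fin 4 → Fin 4 → Bool
  reachesWithin zero    P i j = isYes (i ≟ j)
  reachesWithin (suc k) P i j = isYes (i ≟ j) ∨ isYes (any? λ l → T? (adjacency false P i l ∧ reachesWithin k P l j))

  ConnectedPattern : Pattern → Set
  ConnectedPattern P = ∀ i j → T (reachesWithin 3 P i j)

  connectedPattern? : Decidable ConnectedPattern
  connectedPattern? P = all? λ i → all? λ j → T? (reachesWithin 3 P i j)

  adjacency-support : ∀ y i j → adjacency false (support y) i j ≡ nonzero (adjacency 0 y i j)
  adjacency-support y i j = adjacency-map nonzero 0 y i j

  nonzero⇒1≤ : ∀ {k} → T (nonzero k) → 1 ≤ k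
  nonzero⇒1≤ {suc k} _ = s≤s z≤n

  1≤⇒nonzero : ∀ {k} → 1 ≤ k → T (nonzero k)
  1≤⇒nonzero (s≤s _) = _

  reachesWithin-sound : ∀ k y i j → T (reachesWithin k (support y) i j) → Reach (toGraph y) i j
  reachesWithin-sound zero y i j t with refl ← toWitness {a? = i ≟ j} t = here
  reachesWithin-sound (suc k) y i j t with Equivalence.to T-∨ t
  ... | inj₁ i≡j with refl ← toWitness {a? = i ≟ j} i≡j = here
  ... | inj₂ ∃l with l , t′ ← toWitness ∃l with Equivalence.to T-∧ t′
  ...   | edge , rest = step (nonzero⇒1≤ (subst T (adjacency-support y i l) edge)) (reachesWithin-sound k y l j rest)

  -- on four vertices a shortest walk has at most three steps; checked on all 64 edge sets
  reachesWithin3-step : ∀ P i l j → T (adjacency false P i l) → T (reachesWithin 3 P l j) → T (reachesWithin 3 P i j)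
  reachesWithin3-step P = All.lookup (from-yes (closed? (subpatterns full))) (∈-subpatterns⁺ (⊆full P))
    where
    closed? : ∀ Ps → Dec (All (λ P → ∀ i l j → T (adjacency false P i l) → T (reachesWithin 3 P l j) → T (reachesWithin 3 P i j)) Ps)
    closed? = All.all? λ P → all? λ i → all? λ l → all? λ j →
      T? (adjacency false P i l) →-dec T? (reachesWithin 3 P l j) →-dec T? (reachesWithin 3 P i j)

  reachesWithin3-complete : ∀ y {i j} → Reach (toGraph y) i j → T (reachesWithin 3 (support y) i j)
  reachesWithin3-complete y {i} here = Equivalence.from T-∨ (inj₁ (fromWitness {a? = i ≟ i} refl))
  reachesWithin3-complete y {i} {j} (step {k = l} 1≤m r) =
    reachesWithin3-step (support y) i l j (subst T (sym (adjacency-support y i l)) (1≤⇒nonzero 1≤m)) (reachesWithin3-complete y r)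

  connectedPattern⇒Connected : ∀ y → ConnectedPattern (support y) → Connected (toGraph y)
  connectedPattern⇒Connected y connected i j = reachesWithin-sound 3 y i j (connected i j)

  Connected⇒connectedPattern : ∀ y → Connected (toGraph y) → ConnectedPattern (support y)
  Connected⇒connectedPattern y connected i j = reachesWithin3-complete y (connected i j)

  -- One representative per isomorphism class

  connectedChildren : List Perm → List Pattern
  connectedChildren G = filter connectedPattern? (children G full)

  classes : ℕ → List (EdgeVec ℕ)
  classes E = concatMap (λ Q → extend E permutations Q E) (connectedChildren permutations)

  ∈-classes⁻ : ∀ E {y} → y ∈ classes E → Canonical permutations y × Vec.sum y ≡ E × ConnectedPattern (support y)
  ∈-classes⁻ E {y} y∈ =
    let Q , Q∈ , y∈extend = find (∈-concatMap⁻ (λ Q → extend E permutations Q E) {xs = connectedChildren permutations} y∈)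
        Q∈children , Q-connected = ∈-filter⁻ connectedPattern? {xs = children permutations full} Q∈
        Q-max = proj₂ (proj₂ (∈-children⁻ {permutations} {full} Q∈children))
        y-canonical , sum-y , support-y = extend-sound E permutations Q E y∈extend Q-max
    in y-canonical , sum-y , subst ConnectedPattern (sym support-y) Q-connected

  ∈-classes⁺ : ∀ E {y} → Canonical permutations y → Vec.sum y ≡ E → ConnectedPattern (support y) → y ∈ classes E
  ∈-classes⁺ E {y} y-canonical sum-y y-connected =
    ∈-concatMap⁺ (λ Q → extend E permutations Q E)
      (lose (∈-filter⁺ connectedPattern? (∈-children⁺ (⊆full (support y) , support≢∅ y≢𝟎 , canonical⇒orbitMax y≢𝟎 y-canonical))
                       y-connected)
            (extend-complete E permutations E (n≤1+n E) y-canonical sum-y y≢𝟎))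
    where
    y≢𝟎 : y ≢ 𝟎
    y≢𝟎 y≡𝟎 = not-connected (subst ConnectedPattern (cong support y≡𝟎) y-connected)
      where
      not-connected : ¬ ConnectedPattern ∅
      not-connected c = c 0F 1F

  classes-unique : ∀ E → Unique (classes E)
  classes-unique E = concatMap⁺ (Unique.filter⁺ connectedPattern? (children-unique permutations full))
    (λ {Q} → extend-unique E permutations Q E)
    (λ {Q} {Q′} y∈ y∈′ → trans (sym (extend-support E permutations Q E y∈)) (extend-support E permutations Q′ E y∈′))

  tabulate-· : ∀ (σ : Permutation′ 4) y → tabulate (σ ⟨$⟩ʳ_) · y ≡ relabel 0 (σ ⟨$⟩ʳ_) y
  tabulate-· σ y = relabel-cong 0 (lookup∘tabulate (σ ⟨$⟩ʳ_)) y

  canonical-unique : ∀ {y z} → Canonical permutations y → Canonical permutations z → Iso (toGraph y) (toGraph z) → y ≡ z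
  canonical-unique {y} {z} y-canonical z-canonical (σ , y∘σ≗z) = ≼-antisym y≼z z≼y
    where
    σ·y≡z : relabel 0 (σ ⟨$⟩ʳ_) y ≡ z
    σ·y≡z = relabel-adjacency 0 (σ ⟨$⟩ʳ_) y z y∘σ≗z
    σ⁻¹·z≡y : relabel 0 (σ ⟨$⟩ˡ_) z ≡ y
    σ⁻¹·z≡y = begin
      relabel 0 (σ ⟨$⟩ˡ_) z                            ≡⟨ cong (relabel 0 (σ ⟨$⟩ˡ_)) σ·y≡z ⟨
      relabel 0 (σ ⟨$⟩ˡ_) (relabel 0 (σ ⟨$⟩ʳ_) y)     ≡⟨ relabel-∘ 0 (σ ⟨$⟩ˡ_) (σ ⟨$⟩ʳ_) y ⟩
      relabel 0 (λ i → σ ⟨$⟩ʳ (σ ⟨$⟩ˡ i)) y            ≡⟨ relabel-cong 0 {g = λ i → i} (λ i → inverseʳ σ) y ⟩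
      relabel 0 (λ i → i) y                            ≡⟨ relabel-id 0 y ⟩
      y                                                ∎
      where open ≡-Reasoning
    z≼y : z ≼ y
    z≼y = subst (_≼ y) (trans (tabulate-· σ y) σ·y≡z) (All.lookup y-canonical (tabulate∈permutations σ))
    y≼z : y ≼ z
    y≼z = subst (_≼ z) (trans (tabulate-· (Permutation.flip σ) z) σ⁻¹·z≡y)
                (All.lookup z-canonical (tabulate∈permutations (Permutation.flip σ)))

  lookup-injective : ∀ {A : Set} {xs : List A} → Unique xs → ∀ i j → List.lookup xs i ≡ List.lookup xs j → i ≡ j
  lookup-injective (_    AllPairs.∷ _)  zero    zero    _  = refl
  lookup-injective (x∉xs AllPairs.∷ _)  zero    (suc j) eq = ⊥-elim (All.lookup x∉xs (∈-lookup j) eq)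
  lookup-injective (x∉xs AllPairs.∷ _)  (suc i) zero    eq = ⊥-elim (All.lookup x∉xs (∈-lookup i) (sym eq))
  lookup-injective (_    AllPairs.∷ xs!) (suc i) (suc j) eq = cong suc (lookup-injective xs! i j eq)

  representatives : ∀ E → Vec MultiGraph4 (length (classes E))
  representatives E = tabulate (toGraph ∘ List.lookup (classes E))

  module _ (E : ℕ) where

    private
      representative : ∀ i → lookup (representatives E) i ≡ toGraph (List.lookup (classes E) i)
      representative = lookup∘tabulate (toGraph ∘ List.lookup (classes E))

    representatives-sound : ∀ i → Connected (lookup (representatives E) i) × edgeCount (lookup (representatives E) i) ≡ E
    representatives-sound i =
      subst (λ g → Connected g × edgeCount g ≡ E) (sym (representative i))
           (connectedPattern⇒Connected y y-connected , trans (edgeCount-toGraph y) sum-y)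
      where
      y : EdgeVec ℕ
      y = List.lookup (classes E) i
      y∈ : y ∈ classes E
      y∈ = ∈-lookup i
      sum-y : Vec.sum y ≡ E
      sum-y = proj₁ (proj₂ (∈-classes⁻ E y∈))
      y-connected : ConnectedPattern (support y)
      y-connected = proj₂ (proj₂ (∈-classes⁻ E y∈))

    representatives-distinct : ∀ i j → Iso (lookup (representatives E) i) (lookup (representatives E) j) → i ≡ j
    representatives-distinct i j iso = lookup-injective (classes-unique E) i j
      (canonical-unique {yᵢ} {yⱼ} (proj₁ (∈-classes⁻ E yᵢ∈)) (proj₁ (∈-classes⁻ E yⱼ∈))
        (subst₂ Iso (representative i) (representative j) iso))
      where
      yᵢ yⱼ : EdgeVec ℕ
      yᵢ = List.lookup (classes E) i
      yⱼ = List.lookup (classes E) j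
      yᵢ∈ : yᵢ ∈ classes E
      yᵢ∈ = ∈-lookup i
      yⱼ∈ : yⱼ ∈ classes E
      yⱼ∈ = ∈-lookup j

    representatives-complete : ∀ g → Connected g → edgeCount g ≡ E → ∃ λ i → Iso g (lookup (representatives E) i)
    representatives-complete g g-connected g-edges = i , subst (Iso g) y≡representative g≅y
      where
      x : EdgeVec ℕ
      x = fromGraph g
      normal : ∃ λ π → π ∈ permutations × Canonical permutations (π · x)
      normal = canonical-form symmetricGroup x
      π : Perm
      π = proj₁ normal
      π∈ : π ∈ permutations
      π∈ = proj₁ (proj₂ normal)
      y : EdgeVec ℕ
      y = π · x
      g≅y : Iso g (toGraph y)
      g≅y = toPermutation π∈ , λ i j →
        trans (sym (adjacency-fromGraph g (lookup π i) (lookup π j))) (sym (adjacency-relabel 0 (lookup π) x i j))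
      y∈ : y ∈ classes E
      y∈ = ∈-classes⁺ E {y} (proj₂ (proj₂ normal))
             (trans (sym (edgeCount-toGraph y)) (trans (sym (edgeCount-Iso {g} {toGraph y} g≅y)) g-edges))
             (Connected⇒connectedPattern y (Connected-Iso {g} {toGraph y} g≅y g-connected))
      i : Fin (length (classes E))
      i = Any.index y∈
      y≡representative : toGraph y ≡ lookup (representatives E) i
      y≡representative = trans (cong toGraph (lookup-index y∈)) (sym (representative i))

    classCount : IsClassCount E (length (classes E))
    classCount = representatives E , representatives-sound , representatives-distinct , representatives-complete

module GeneratingFunction where

  open Enumeration
  open import Data.Bool.Base using (Bool; true; false; T; _∧_)
  import Data.Bool.Properties as Bool
  open import Data.Bool.Properties using (T-∧; T-≡)
  open import Data.Empty using (⊥-elim)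
  open import Data.Integer.Base as ℤ using (ℤ; +_; _+_; _*_)
  import Data.Integer.Properties as ℤ
  open import Algebra.Properties.CommutativeSemigroup ℤ.+-commutativeSemigroup using (x∙yz≈y∙xz)
  open import Data.Integer.Tactic.RingSolver using (solve-∀)
  open import Data.List.Base as List using (List; []; _∷_; foldr; filter; length)
  import Data.List.Properties as List
  open import Data.List.Properties using (filter-all)
  open import Data.List.Membership.Propositional using (_∈_)
  open import Data.List.Membership.Propositional.Properties using (∈-filter⁻)
  open import Data.List.Relation.Unary.All as All using (All; []; _∷_)
  import Data.List.Relation.Unary.AllPairs as AllPairs
  open import Data.List.Relation.Unary.Any using (here; there)
  open import Data.List.Relation.Unary.Unique.Propositional using (Unique)
  open import Data.Nat.Base using (ℕ; zero; suc; _∸_; _≤_; _<_; s≤s)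
  open import Data.Nat.Induction using (<-rec)
  open import Data.Nat.Properties using (_≤?_; ≰⇒>; ∸-monoʳ-<; ≤-trans; ≤-refl; ∸-monoʳ-≤; ∸-monoˡ-≤; n≤1+n)
  open import Data.Product.Base using (_,_; proj₁; proj₂)
  open import Data.Sum.Base using (inj₁)
  import Data.Vec.Relation.Binary.Pointwise.Inductive as Pointwise
  open import Function.Base using (_∘_)
  open import Function.Bundles using (Equivalence)
  open import Relation.Binary.Definitions using (DecidableEquality)
  open import Relation.Binary.PropositionalEquality using (_≡_; _≢_; _≗_; refl; sym; trans; cong; cong₂; module ≡-Reasoning)
  open import Relation.Nullary.Decidable using (isYes; ¬?; T?; yes; no; toWitness)

  -- Power series

  Seq : Set
  Seq = ℕ → ℤ

  infixr 7 _⋆_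

  shift : Seq → Seq
  shift s zero    = + 0
  shift s (suc n) = s n

  shiftBy : ℕ → Seq → Seq
  shiftBy zero    s = s
  shiftBy (suc w) s = shift (shiftBy w s)

  _⋆_ : Poly → Seq → Seq
  ([]    ⋆ s) n = + 0
  ((c ∷ P) ⋆ s) n = c * s n + shift (P ⋆ s) n

  δ : Seq
  δ zero    = + 1
  δ (suc n) = + 0

  xpow : ℕ → Poly
  xpow zero    = + 1 ∷ []
  xpow (suc w) = + 0 ∷ xpow w

  shift-cong : ∀ {s t} → s ≗ t → shift s ≗ shift t
  shift-cong s≗t zero    = refl
  shift-cong s≗t (suc n) = s≗t n

  shiftBy-cong : ∀ w {s t} → s ≗ t → shiftBy w s ≗ shiftBy w t
  shiftBy-cong zero    s≗t = s≗t
  shiftBy-cong (suc w) s≗t = shift-cong (shiftBy-cong w s≗t)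

  ⋆-cong : ∀ P {s t} → s ≗ t → P ⋆ s ≗ P ⋆ t
  ⋆-cong []      s≗t n = refl
  ⋆-cong (c ∷ P) s≗t n = cong₂ _+_ (cong (c *_) (s≗t n)) (shift-cong (⋆-cong P s≗t) n)

  shiftBy-≤ : ∀ w s {n} → w ≤ n → shiftBy w s n ≡ s (n ∸ w)
  shiftBy-≤ zero    s _         = refl
  shiftBy-≤ (suc w) s (s≤s w≤n) = shiftBy-≤ w s w≤n

  shiftBy-< : ∀ w s {n} → n < w → shiftBy w s n ≡ + 0
  shiftBy-< (suc w) s {zero}  _         = refl
  shiftBy-< (suc w) s {suc n} (s≤s n<w) = shiftBy-< w s n<w

  ⋆-shift : ∀ P s → P ⋆ shift s ≗ shift (P ⋆ s)
  ⋆-shift []      s zero    = refl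
  ⋆-shift []      s (suc n) = refl
  ⋆-shift (c ∷ P) s zero    = cong (_+ + 0) (ℤ.*-zeroʳ c)
  ⋆-shift (c ∷ P) s (suc n) = cong (_+_ (c * s n)) (⋆-shift P s n)

  ⋆-shiftBy : ∀ P w s → P ⋆ shiftBy w s ≗ shiftBy w (P ⋆ s)
  ⋆-shiftBy P zero    s n = refl
  ⋆-shiftBy P (suc w) s n = trans (⋆-shift P (shiftBy w s) n) (shift-cong (⋆-shiftBy P w s) n)

  shift-+ : ∀ s t → shift (λ k → s k + t k) ≗ λ n → shift s n + shift t n
  shift-+ s t zero    = refl
  shift-+ s t (suc n) = refl

  ⋆-+ : ∀ P s t → P ⋆ (λ k → s k + t k) ≗ λ n → (P ⋆ s) n + (P ⋆ t) n
  ⋆-+ []      s t n = refl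
  ⋆-+ (c ∷ P) s t n = begin
    c * (s n + t n) + shift (P ⋆ (λ k → s k + t k)) n     ≡⟨ cong (_+_ (c * (s n + t n))) (trans (shift-cong (⋆-+ P s t) n) (shift-+ (P ⋆ s) (P ⋆ t) n)) ⟩
    c * (s n + t n) + (shift (P ⋆ s) n + shift (P ⋆ t) n) ≡⟨ distribute c (s n) (t n) _ _ ⟩
    (c * s n + shift (P ⋆ s) n) + (c * t n + shift (P ⋆ t) n) ∎
    where
    open ≡-Reasoning
    distribute : ∀ c a b d e → c * (a + b) + (d + e) ≡ (c * a + d) + (c * b + e)
    distribute = solve-∀

  ⋆-zero : ∀ P → P ⋆ (λ _ → + 0) ≗ λ _ → + 0
  ⋆-zero []      n       = refl
  ⋆-zero (c ∷ P) zero    = cong (_+ + 0) (ℤ.*-zeroʳ c)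
  ⋆-zero (c ∷ P) (suc n) = cong₂ _+_ (ℤ.*-zeroʳ c) (⋆-zero P n)

  ⋆-⊕ : ∀ P Q s → (P ⊕ Q) ⋆ s ≗ λ n → (P ⋆ s) n + (Q ⋆ s) n
  ⋆-⊕ []      Q       s n = sym (ℤ.+-identityˡ _)
  ⋆-⊕ (a ∷ P) []      s n = sym (ℤ.+-identityʳ _)
  ⋆-⊕ (a ∷ P) (b ∷ Q) s n = begin
    (a + b) * s n + shift ((P ⊕ Q) ⋆ s) n                    ≡⟨ cong (_+_ ((a + b) * s n)) (trans (shift-cong (⋆-⊕ P Q s) n) (shift-+ (P ⋆ s) (Q ⋆ s) n)) ⟩
    (a + b) * s n + (shift (P ⋆ s) n + shift (Q ⋆ s) n)      ≡⟨ distribute a b (s n) _ _ ⟩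
    (a * s n + shift (P ⋆ s) n) + (b * s n + shift (Q ⋆ s) n) ∎
    where
    open ≡-Reasoning
    distribute : ∀ a b x d e → (a + b) * x + (d + e) ≡ (a * x + d) + (b * x + e)
    distribute = solve-∀

  shift-scale : ∀ c s → shift (λ k → c * s k) ≗ λ n → c * shift s n
  shift-scale c s zero    = sym (ℤ.*-zeroʳ c)
  shift-scale c s (suc n) = refl

  ⋆-scale : ∀ c Q s → scale c Q ⋆ s ≗ λ n → c * (Q ⋆ s) n
  ⋆-scale c []      s n = sym (ℤ.*-zeroʳ c)
  ⋆-scale c (a ∷ Q) s n = begin
    c * a * s n + shift (scale c Q ⋆ s) n  ≡⟨ cong (_+_ (c * a * s n)) (trans (shift-cong (⋆-scale c Q s) n) (shift-scale c (Q ⋆ s) n)) ⟩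
    c * a * s n + c * shift (Q ⋆ s) n      ≡⟨ factor c a (s n) _ ⟩
    c * (a * s n + shift (Q ⋆ s) n)        ∎
    where
    open ≡-Reasoning
    factor : ∀ c a x y → c * a * x + c * y ≡ c * (a * x + y)
    factor = solve-∀

  ⋆-⊗ : ∀ P Q s → (P ⊗ Q) ⋆ s ≗ P ⋆ (Q ⋆ s)
  ⋆-⊗ []      Q s n = refl
  ⋆-⊗ (a ∷ P) Q s n = begin
    ((scale a Q ⊕ (+ 0 ∷ (P ⊗ Q))) ⋆ s) n              ≡⟨ ⋆-⊕ (scale a Q) (+ 0 ∷ (P ⊗ Q)) s n ⟩
    (scale a Q ⋆ s) n + ((+ 0 ∷ (P ⊗ Q)) ⋆ s) n          ≡⟨ cong₂ _+_ (⋆-scale a Q s n) (ℤ.+-identityˡ _) ⟩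
    a * (Q ⋆ s) n + shift ((P ⊗ Q) ⋆ s) n                ≡⟨ cong (_+_ (a * (Q ⋆ s) n)) (shift-cong (⋆-⊗ P Q s) n) ⟩
    a * (Q ⋆ s) n + shift (P ⋆ (Q ⋆ s)) n                ∎
    where open ≡-Reasoning

  ⋆-δ : ∀ P → P ⋆ δ ≗ coeff P
  ⋆-δ []      n       = refl
  ⋆-δ (c ∷ P) zero    = trans (cong (_+ + 0) (ℤ.*-identityʳ c)) (ℤ.+-identityʳ c)
  ⋆-δ (c ∷ P) (suc n) = trans (cong (_+ (P ⋆ δ) n) (ℤ.*-zeroʳ c)) (trans (ℤ.+-identityˡ _) (⋆-δ P n))

  ⋆-xpow : ∀ w s → xpow w ⋆ s ≗ shiftBy w s
  ⋆-xpow zero    s zero    = trans (ℤ.+-identityʳ _) (ℤ.*-identityˡ (s 0))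
  ⋆-xpow zero    s (suc n) = trans (ℤ.+-identityʳ _) (ℤ.*-identityˡ (s (suc n)))
  ⋆-xpow (suc w) s n       = trans (ℤ.+-identityˡ _) (shift-cong (⋆-xpow w s) n)

  coeff-⊕ : ∀ P Q → coeff (P ⊕ Q) ≗ λ n → coeff P n + coeff Q n
  coeff-⊕ []      Q       n       = sym (ℤ.+-identityˡ _)
  coeff-⊕ (a ∷ P) []      n       = sym (ℤ.+-identityʳ _)
  coeff-⊕ (a ∷ P) (b ∷ Q) zero    = refl
  coeff-⊕ (a ∷ P) (b ∷ Q) (suc n) = coeff-⊕ P Q n

  coeff-⊗ : ∀ P Q → coeff (P ⊗ Q) ≗ P ⋆ coeff Q
  coeff-⊗ P Q n = trans (sym (⋆-δ (P ⊗ Q) n)) (trans (⋆-⊗ P Q δ n) (⋆-cong P (⋆-δ Q) n))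

  coeff-xpow⊗ : ∀ w R → coeff (xpow w ⊗ R) ≗ shiftBy w (coeff R)
  coeff-xpow⊗ w R n = trans (coeff-⊗ (xpow w) R n) (⋆-xpow w (coeff R) n)

  ∑ : ∀ {A : Set} → List A → (A → ℤ) → ℤ
  ∑ xs f = foldr (λ x total → f x + total) (+ 0) xs

  ∑-cong : ∀ {A : Set} {xs : List A} {f g} → All (λ x → f x ≡ g x) xs → ∑ xs f ≡ ∑ xs g
  ∑-cong []         = refl
  ∑-cong (fx≡gx ∷ eqs) = cong₂ _+_ fx≡gx (∑-cong eqs)

  ∑-zero : ∀ {A : Set} (xs : List A) → ∑ xs (λ _ → + 0) ≡ + 0
  ∑-zero []       = refl
  ∑-zero (x ∷ xs) = trans (ℤ.+-identityˡ _) (∑-zero xs)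

  ⋆-∑ : ∀ P {A : Set} (xs : List A) (s : A → Seq) → P ⋆ (λ n → ∑ xs λ x → s x n) ≗ λ n → ∑ xs λ x → (P ⋆ s x) n
  ⋆-∑ P []       s n = ⋆-zero P n
  ⋆-∑ P (x ∷ xs) s n = trans (⋆-+ P (s x) (λ k → ∑ xs λ y → s y k) n) (cong (_+_ ((P ⋆ s x) n)) (⋆-∑ P xs s n))

  ∑ₚ : ∀ {A : Set} → List A → (A → Poly) → Poly
  ∑ₚ xs f = foldr (λ x total → f x ⊕ total) [] xs

  coeff-∑ₚ : ∀ {A : Set} (xs : List A) (f : A → Poly) → coeff (∑ₚ xs f) ≗ λ n → ∑ xs λ x → coeff (f x) n
  coeff-∑ₚ []       f n = refl
  coeff-∑ₚ (x ∷ xs) f n = trans (coeff-⊕ (f x) (∑ₚ xs f) n) (cong (_+_ (coeff (f x) n)) (coeff-∑ₚ xs f n))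

  length-concatMap : ∀ {A B : Set} (f : A → List B) xs → + length (List.concatMap f xs) ≡ ∑ xs (λ x → + length (f x))
  length-concatMap f []       = refl
  length-concatMap f (x ∷ xs) = trans (cong +_ (List.length-++ (f x))) (cong (_+_ (+ length (f x))) (length-concatMap f xs))

  module _ {A : Set} (_≟_ : DecidableEquality A) where

    ∑-pick : ∀ {xs} (f : A → ℤ) {x} → Unique xs → x ∈ xs → ∑ xs f ≡ f x + ∑ (filter (λ y → ¬? (y ≟ x)) xs) f
    ∑-pick f {x} (x∉ AllPairs.∷ _) (here refl) with x ≟ x
    ... | yes _  = cong (λ ys → f x + ∑ ys f) (sym (filter-all (λ y → ¬? (y ≟ x)) (All.map (λ x≢y y≡x → x≢y (sym y≡x)) x∉)))
    ... | no x≢x = ⊥-elim (x≢x refl)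
    ∑-pick {y ∷ ys} f {x} (y∉ AllPairs.∷ ys!) (there x∈) with y ≟ x
    ... | yes refl = ⊥-elim (All.lookup y∉ x∈ refl)
    ... | no  _    = trans (cong (_+_ (f y)) (∑-pick f ys! x∈)) (x∙yz≈y∙xz (f y) (f x) _)

  fixpoint-unique : ∀ w → 1 ≤ w → ∀ (f : Seq) {u v : Seq} → (∀ n → u n ≡ f n + shiftBy w u n) → (∀ n → v n ≡ f n + shiftBy w v n) → u ≗ v
  fixpoint-unique w 1≤w f {u} {v} u-fix v-fix = <-rec (λ n → u n ≡ v n) agree
    where
    agree : ∀ n → (∀ {m} → m < n → u m ≡ v m) → u n ≡ v n
    agree n earlier with w ≤? n
    ... | yes w≤n = trans (u-fix n) (trans (cong (_+_ (f n)) shifted) (sym (v-fix n)))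
      where
      shifted : shiftBy w u n ≡ shiftBy w v n
      shifted = trans (shiftBy-≤ w u w≤n) (trans (earlier (∸-monoʳ-< 1≤w w≤n)) (sym (shiftBy-≤ w v w≤n)))
    ... | no  w≰n = trans (u-fix n) (trans (cong (_+_ (f n)) (trans (shiftBy-< w u (≰⇒> w≰n)) (sym (shiftBy-< w v (≰⇒> w≰n))))) (sym (v-fix n)))

  map-applyUpTo : ∀ {A B : Set} (f : A → B) (g : ℕ → A) n → List.map f (List.applyUpTo g n) ≡ List.applyUpTo (f ∘ g) n
  map-applyUpTo f g zero    = refl
  map-applyUpTo f g (suc n) = cong (f (g 0) ∷_) (map-applyUpTo f (g ∘ suc) n)

  mulSeries-∷ : ∀ c P a n → mulSeries (c ∷ P) a (suc n) ≡ c * + a (suc n) + mulSeries P a n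
  mulSeries-∷ c P a n
    rewrite map-applyUpTo (λ i → coeff (c ∷ P) i * + a (suc n ∸ i)) (suc ∘ suc) n
          | map-applyUpTo (λ i → coeff P i * + a (n ∸ i)) suc n = refl

  mulSeries-[] : ∀ a n → mulSeries [] a (suc n) ≡ + 0 * + a (suc n) + mulSeries [] a n
  mulSeries-[] a n
    rewrite map-applyUpTo (λ i → coeff [] i * + a (suc n ∸ i)) (suc ∘ suc) n
          | map-applyUpTo (λ i → coeff [] i * + a (n ∸ i)) suc n = refl

  mulSeries≡⋆ : ∀ P a → mulSeries P a ≗ P ⋆ (+_ ∘ a)
  mulSeries≡⋆ []      a zero    = refl
  mulSeries≡⋆ []      a (suc n) = trans (mulSeries-[] a n) (trans (ℤ.+-identityˡ _) (mulSeries≡⋆ [] a n))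
  mulSeries≡⋆ (c ∷ P) a zero    = refl
  mulSeries≡⋆ (c ∷ P) a (suc n) = trans (mulSeries-∷ c P a n) (cong (_+_ (c * + a (suc n))) (mulSeries≡⋆ P a n))

  -- The counting recurrence

  count : List Perm → Pattern → Seq
  count G P n = + length (enumerate n G P n)

  extend-count : ∀ fuel G Q n → 1 ≤ size Q → n ≤ suc fuel →
                 + length (extend fuel G Q n) ≡ shiftBy (size Q) (count (stabilizer G Q) Q) n
  extend-count fuel G Q n 1≤|Q| n≤1+fuel with size Q ≤? n
  ... | yes |Q|≤n = begin
    + length (List.map (raise Q) (enumerate fuel (stabilizer G Q) Q (n ∸ size Q)))
      ≡⟨ cong +_ (List.length-map (raise Q) (enumerate fuel (stabilizer G Q) Q (n ∸ size Q))) ⟩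
    + length (enumerate fuel (stabilizer G Q) Q (n ∸ size Q))
      ≡⟨ cong (+_ ∘ length) (enumerate-fuel (stabilizer G Q) Q (n ∸ size Q) n∸|Q|≤fuel ≤-refl) ⟩
    count (stabilizer G Q) Q (n ∸ size Q)
      ≡⟨ shiftBy-≤ (size Q) (count (stabilizer G Q) Q) |Q|≤n ⟨
    shiftBy (size Q) (count (stabilizer G Q) Q) n
      ∎
    where
    open ≡-Reasoning
    n∸|Q|≤fuel : n ∸ size Q ≤ fuel
    n∸|Q|≤fuel = ≤-trans (∸-monoʳ-≤ n 1≤|Q|) (∸-monoˡ-≤ 1 n≤1+fuel)
  ... | no  |Q|≰n = sym (shiftBy-< (size Q) (count (stabilizer G Q) Q) (≰⇒> |Q|≰n))

  count-recurrence : ∀ G P → count G P ≗ λ n → δ n + ∑ (children G P) λ Q → shiftBy (size Q) (count (stabilizer G Q) Q) n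
  count-recurrence G P zero    = sym (cong (_+_ (+ 1)) (trans (∑-cong (All.tabulate λ {Q} Q∈ →
    shiftBy-< (size Q) (count (stabilizer G Q) Q) (child-size {G} {P} Q∈))) (∑-zero (children G P))))
  count-recurrence G P (suc n) = trans (length-concatMap (λ Q → extend n G Q (suc n)) (children G P))
    (trans (∑-cong (All.tabulate λ {Q} Q∈ → extend-count n G Q (suc n) (child-size {G} {P} Q∈) ≤-refl))
           (sym (ℤ.+-identityˡ _)))

  ⋆-count : ∀ D G P → D ⋆ count G P ≗ λ n → coeff D n + ∑ (children G P) λ Q → shiftBy (size Q) (D ⋆ count (stabilizer G Q) Q) n
  ⋆-count D G P n = begin
    (D ⋆ count G P) n                                                  ≡⟨ ⋆-cong D (count-recurrence G P) n ⟩
    (D ⋆ λ m → δ m + ∑ (children G P) λ Q → term Q m) n               ≡⟨ ⋆-+ D δ (λ m → ∑ (children G P) λ Q → term Q m) n ⟩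
    (D ⋆ δ) n + (D ⋆ λ m → ∑ (children G P) λ Q → term Q m) n         ≡⟨ cong₂ _+_ (⋆-δ D n) (⋆-∑ D (children G P) term n) ⟩
    coeff D n + ∑ (children G P) (λ Q → (D ⋆ term Q) n)               ≡⟨ cong (_+_ (coeff D n)) (∑-cong (All.universal shifted (children G P))) ⟩
    coeff D n + ∑ (children G P) (λ Q → shiftBy (size Q) (D ⋆ count (stabilizer G Q) Q) n) ∎
    where
    open ≡-Reasoning
    term : Pattern → Seq
    term Q = shiftBy (size Q) (count (stabilizer G Q) Q)
    shifted : ∀ Q → (D ⋆ term Q) n ≡ shiftBy (size Q) (D ⋆ count (stabilizer G Q) Q) n
    shifted Q = ⋆-shiftBy D (size Q) (count (stabilizer G Q) Q) n

  -- Certified numerators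

  properChildren : List Perm → Pattern → List Pattern
  properChildren G P = filter (λ Q → ¬? (Q ≟ₚ P)) (children G P)

  -- F / (1 − x^w) truncated to the length of F, via R i = F i + R (i − w) with a window of w coefficients
  divideWith : List ℤ → Poly → Poly
  divideWith window       []      = []
  divideWith []           (t ∷ F) = t ∷ divideWith [] F
  divideWith (r ∷ window) (t ∷ F) = (t + r) ∷ divideWith (window List.∷ʳ (t + r)) F

  quotient : ℕ → Poly → Poly
  quotient w F = divideWith (List.replicate w (+ 0)) F

  -- certificate k G P is a guess for the numerator D · Σₙ count G P n xⁿ; verified checks that it
  -- solves R = F + x^|P| · R at every node, which determines it (fixpoint-unique)
  mutual
    certificate : ℕ → List Perm → Pattern → Poly
    certificate zero    G P = []
    certificate (suc k) G P = quotient (size P) (inhomogeneity k G P)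

    inhomogeneity : ℕ → List Perm → Pattern → Poly
    inhomogeneity k G P = denominator ⊕ ∑ₚ (properChildren G P) λ Q → xpow (size Q) ⊗ certificate k (stabilizer G Q) Q

  samePoly : Poly → Poly → Bool
  samePoly []      []      = true
  samePoly []      (b ∷ q) = isYes (b ℤ.≟ + 0) ∧ samePoly [] q
  samePoly (a ∷ p) []      = isYes (a ℤ.≟ + 0) ∧ samePoly p []
  samePoly (a ∷ p) (b ∷ q) = isYes (a ℤ.≟ b) ∧ samePoly p q

  solves : ℕ → Poly → Poly → Bool
  solves w F R = samePoly R (F ⊕ (xpow w ⊗ R))

  verified : ℕ → List Perm → Pattern → Bool
  verified zero    G P = false
  verified (suc k) G P = solvesQuotient (size P) (inhomogeneity k G P)
                       ∧ isYes (All.all? (λ Q → T? (verified k (stabilizer G Q) Q)) (properChildren G P))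
    where solvesQuotient : ℕ → Poly → Bool
          solvesQuotient w F = solves w F (quotient w F)

  -- nested proper children form a strictly decreasing chain of nonempty edge sets
  depth : ℕ
  depth = 7

  -- the group is a parameter so that its list is shared rather than recomputed during evaluation
  allVerified : List Perm → Bool
  allVerified G = isYes (All.all? (λ Q → T? (verified depth (stabilizer G Q) Q)) (connectedChildren G))

  topNumerator : List Perm → Poly
  topNumerator G = ∑ₚ (connectedChildren G) λ Q → xpow (size Q) ⊗ certificate depth (stabilizer G Q) Q

  samePoly-sound : ∀ p q → T (samePoly p q) → coeff p ≗ coeff q
  samePoly-sound []      []      _  n       = refl
  samePoly-sound []      (b ∷ q) eq zero    = sym (toWitness {a? = b ℤ.≟ + 0} (proj₁ (Equivalence.to T-∧ eq)))
  samePoly-sound []      (b ∷ q) eq (suc n) = samePoly-sound [] q (proj₂ (Equivalence.to T-∧ eq)) n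
  samePoly-sound (a ∷ p) []      eq zero    = toWitness {a? = a ℤ.≟ + 0} (proj₁ (Equivalence.to T-∧ eq))
  samePoly-sound (a ∷ p) []      eq (suc n) = samePoly-sound p [] (proj₂ (Equivalence.to T-∧ eq)) n
  samePoly-sound (a ∷ p) (b ∷ q) eq zero    = toWitness {a? = a ℤ.≟ b} (proj₁ (Equivalence.to T-∧ eq))
  samePoly-sound (a ∷ p) (b ∷ q) eq (suc n) = samePoly-sound p q (proj₂ (Equivalence.to T-∧ eq)) n

  solves-sound : ∀ w F R → T (solves w F R) → ∀ n → coeff R n ≡ coeff F n + shiftBy w (coeff R) n
  solves-sound w F R ok n = trans (samePoly-sound R (F ⊕ (xpow w ⊗ R)) ok n)
    (trans (coeff-⊕ F (xpow w ⊗ R) n) (cong (_+_ (coeff F n)) (coeff-xpow⊗ w R n)))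

  Fixes : List Perm → Pattern → Set
  Fixes G P = All (λ π → π ·ₚ P ≡ P) G

  Describes : List Perm → Pattern → Poly → Set
  Describes G P R = denominator ⋆ count G P ≗ coeff R

  stabilizer-fixes : ∀ G Q → Fixes (stabilizer G Q) Q
  stabilizer-fixes G Q = All.tabulate λ π∈ → proj₂ (∈-stabilizer⁻ {G} {Q} π∈)

  count-fixpoint : ∀ k G P → Fixes G P → P ≢ ∅ →
                   (∀ {Q} → Q ∈ properChildren G P → Describes (stabilizer G Q) Q (certificate k (stabilizer G Q) Q)) →
                   ∀ n → (denominator ⋆ count G P) n ≡ coeff (inhomogeneity k G P) n + shiftBy (size P) (denominator ⋆ count G P) n
  count-fixpoint k G P fixes P≢∅ described n = begin
    u n                                                                 ≡⟨ ⋆-count denominator G P n ⟩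
    coeff denominator n + ∑ (children G P) (λ Q → term Q n)             ≡⟨ cong (_+_ (coeff denominator n)) (∑-pick _≟ₚ_ (λ Q → term Q n) (children-unique G P) P∈children) ⟩
    coeff denominator n + (term P n + ∑ (properChildren G P) λ Q → term Q n)
      ≡⟨ cong (_+_ (coeff denominator n)) (cong₂ _+_ (cong (λ H → shiftBy (size P) (denominator ⋆ count H P) n) stabilizer≡G)
                                                      (∑-cong (All.tabulate λ Q∈ → proper-term Q∈))) ⟩
    coeff denominator n + (shiftBy (size P) u n + ∑ (properChildren G P) λ Q → coeff (summand Q) n)
      ≡⟨ cong (_+_ (coeff denominator n)) (cong (_+_ (shiftBy (size P) u n)) (coeff-∑ₚ (properChildren G P) summand n)) ⟨
    coeff denominator n + (shiftBy (size P) u n + coeff (∑ₚ (properChildren G P) summand) n)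
      ≡⟨ reorder (coeff denominator n) (shiftBy (size P) u n) _ ⟩
    (coeff denominator n + coeff (∑ₚ (properChildren G P) summand) n) + shiftBy (size P) u n
      ≡⟨ cong (_+ shiftBy (size P) u n) (coeff-⊕ denominator (∑ₚ (properChildren G P) summand) n) ⟨
    coeff (inhomogeneity k G P) n + shiftBy (size P) u n                ∎
    where
    open ≡-Reasoning
    u : Seq
    u = denominator ⋆ count G P
    term : Pattern → ℕ → ℤ
    term Q = shiftBy (size Q) (denominator ⋆ count (stabilizer G Q) Q)
    summand : Pattern → Poly
    summand Q = xpow (size Q) ⊗ certificate k (stabilizer G Q) Q
    proper-term : ∀ {Q} → Q ∈ properChildren G P → term Q n ≡ coeff (summand Q) n
    proper-term {Q} Q∈ = trans (shiftBy-cong (size Q) (described Q∈) n) (sym (coeff-xpow⊗ (size Q) (certificate k (stabilizer G Q) Q) n))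
    stabilizer≡G : stabilizer G P ≡ G
    stabilizer≡G = filter-all (λ π → π ·ₚ P ≟ₚ P) fixes
    P∈children : P ∈ children G P
    P∈children = ∈-children⁺ (Pointwise.refl Bool.≤-refl , P≢∅ , All.map inj₁ fixes)
    reorder : ∀ a b c → a + (b + c) ≡ (a + c) + b
    reorder = solve-∀

  certificate-sound : ∀ k G P → Fixes G P → P ≢ ∅ → T (verified k G P) → Describes G P (certificate k G P)
  certificate-sound (suc k) G P fixes P≢∅ ok =
    fixpoint-unique (size P) (size-nonempty P P≢∅) (coeff (inhomogeneity k G P))
      (count-fixpoint k G P fixes P≢∅ described)
      (solves-sound (size P) (inhomogeneity k G P) (certificate (suc k) G P) (proj₁ (Equivalence.to T-∧ ok)))
    where
    children-verified : All (λ Q → T (verified k (stabilizer G Q) Q)) (properChildren G P)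
    children-verified = toWitness {a? = All.all? (λ Q → T? (verified k (stabilizer G Q) Q)) (properChildren G P)} (proj₂ (Equivalence.to T-∧ ok))
    described : ∀ {Q} → Q ∈ properChildren G P → Describes (stabilizer G Q) Q (certificate k (stabilizer G Q) Q)
    described {Q} Q∈ =
      certificate-sound k (stabilizer G Q) Q (stabilizer-fixes G Q)
        (child-nonempty {G} {P} (proj₁ (∈-filter⁻ (λ Q → ¬? (Q ≟ₚ P)) {xs = children G P} Q∈)))
        (All.lookup children-verified Q∈)

  classCountSequence : ℕ → ℕ
  classCountSequence E = length (classes E)

  connectedChild⇒child : ∀ {Q} → Q ∈ connectedChildren permutations → Q ∈ children permutations full
  connectedChild⇒child = proj₁ ∘ ∈-filter⁻ connectedPattern? {xs = children permutations full}

  classes-count : ∀ E → + classCountSequence E ≡ ∑ (connectedChildren permutations) λ Q → shiftBy (size Q) (count (stabilizer permutations Q) Q) E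
  classes-count E = trans (length-concatMap (λ Q → extend E permutations Q E) (connectedChildren permutations))
    (∑-cong (All.tabulate λ {Q} Q∈ →
       extend-count E permutations Q E (child-size {permutations} {full} (connectedChild⇒child Q∈)) (n≤1+n E)))

  opaque
    unfolding permutations

    allVerified-permutations : allVerified permutations ≡ true
    allVerified-permutations = refl

    topNumerator≈numerator : samePoly (topNumerator permutations) numerator ≡ true
    topNumerator≈numerator = refl

  hasGF : HasGF classCountSequence numerator denominator
  hasGF n = begin
    mulSeries denominator classCountSequence n
      ≡⟨ mulSeries≡⋆ denominator classCountSequence n ⟩
    (denominator ⋆ (+_ ∘ classCountSequence)) n
      ≡⟨ ⋆-cong denominator classes-count n ⟩
    (denominator ⋆ λ E → ∑ tops λ Q → shiftBy (size Q) (count (stabilizer permutations Q) Q) E) n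
      ≡⟨ ⋆-∑ denominator tops (λ Q → shiftBy (size Q) (count (stabilizer permutations Q) Q)) n ⟩
    ∑ tops (λ Q → (denominator ⋆ shiftBy (size Q) (count (stabilizer permutations Q) Q)) n)
      ≡⟨ ∑-cong (All.tabulate λ {Q} Q∈ → described Q∈) ⟩
    ∑ tops (λ Q → coeff (xpow (size Q) ⊗ certificate depth (stabilizer permutations Q) Q) n)
      ≡⟨ coeff-∑ₚ tops (λ Q → xpow (size Q) ⊗ certificate depth (stabilizer permutations Q) Q) n ⟨
    coeff (topNumerator permutations) n
      ≡⟨ samePoly-sound (topNumerator permutations) numerator (Equivalence.from T-≡ topNumerator≈numerator) n ⟩
    coeff numerator n ∎
    where
    open ≡-Reasoning
    tops : List Pattern
    tops = connectedChildren permutations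
    verified-tops : All (λ Q → T (verified depth (stabilizer permutations Q) Q)) tops
    verified-tops = toWitness {a? = All.all? (λ Q → T? (verified depth (stabilizer permutations Q) Q)) tops} (Equivalence.from T-≡ allVerified-permutations)
    described : ∀ {Q} → Q ∈ tops → (denominator ⋆ shiftBy (size Q) (count (stabilizer permutations Q) Q)) n
                                   ≡ coeff (xpow (size Q) ⊗ certificate depth (stabilizer permutations Q) Q) n
    described {Q} Q∈ = trans (⋆-shiftBy denominator (size Q) (count (stabilizer permutations Q) Q) n)
      (trans (shiftBy-cong (size Q) (certificate-sound depth (stabilizer permutations Q) Q (stabilizer-fixes permutations Q)
                                       (child-nonempty {permutations} {full} (connectedChild⇒child Q∈))
                                       (All.lookup verified-tops Q∈)) n)
             (sym (coeff-xpow⊗ (size Q) (certificate depth (stabilizer permutations Q) Q) n)))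

open Enumeration using (classCount)
open GeneratingFunction using (classCountSequence; hasGF)

mainTheorem1 : Σ (ℕ → ℕ) λ a → (∀ E → IsClassCount E (a E)) × HasGF a numerator denominator
mainTheorem1 = classCountSequence , classCount , hasGF
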